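{- Let $q$ be a power of an odd prime, $d\ge1$, and $m=(m_1,\dots,m_d)\in\mathbb{F}_q^d$. For each $\alpha\in\{0,1,\dots,d\}$ and $s\in\mathbb{F}_q$, $$\sum_{x\in N_\alpha}\chi_1(s\|x\|-m\cdot x)=\begin{cases}\displaystyle\sum_{\substack{I\subset[d]\\ |I|=d-\alpha}}\ \prod_{i\in I}\Big(\eta(s)\mathcal{G}_1\,\chi_1\Big(-\frac{m_i^2}{4s}\Big)-1\Big) & \text{if } s\neq 0,\\[2ex] \displaystyle\sum_{\substack{I\subset[d]\\ |I|=d-\alpha}}(q-1)^{\mathcal{Z}(m_I)}(-1)^{d-\alpha-\mathcal{Z}(m_I)} & \text{if } s=0,\end{cases}$$ where an empty product (the case $\alpha=d$, $I=\emptyset$) equals $1$.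
   Context: $\mathbb{F}_q$ is the finite field with $q=p^r$ elements, $p$ an odd prime. $\chi_1:\mathbb{F}_q\to\mathbb{C}$ is the additive character $\chi_1(c)=e^{2\pi i\,\mathrm{Tr}(c)/p}$, where $\mathrm{Tr}$ is the absolute trace $\mathbb{F}_q\to\mathbb{F}_p$. $\eta$ is the quadratic character of $\mathbb{F}_q^*$: $\eta(c)=1$ if $c$ is a square and $\eta(c)=-1$ otherwise. $\mathcal{G}_1=\sum_{c\in\mathbb{F}_q^*}\eta(c)\chi_1(c)$. For $x\in\mathbb{F}_q^d$, $\|x\|=x_1^2+\cdots+x_d^2$, $m\cdot x=\sum_i m_ix_i$, and $\mathcal{Z}(x)$ is the number of zero coordinates of $x$. $[d]=\{1,\dots,d\}$. For $\alpha\in\{0,\dots,d\}$, $N_\alpha=\{x\in\mathbb{F}_q^d:\mathcal{Z}(x)=\alpha\}$. For $I\subset[d]$, $\mathcal{Z}(m_I)$ denotes the number of indices $i\in I$ with $m_i=0$ (so $\mathcal{Z}(m_\emptyset)=0$). -}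

module Defs where

open import Level using (0ℓ)
open import Data.Bool using (Bool; true; false; if_then_else_)
open import Data.Bool.ListAction using (any)
open import Data.Nat as ℕ using (ℕ; zero; suc; _^_; _≤_)
open import Data.Nat.Primality using (Prime)
open import Data.Integer as ℤ using (ℤ; +_; -[1+_])
open import Data.Fin as Fin using (Fin; toℕ)
open import Data.Fin.Subset using (Subset; inside; outside; ∣_∣)
open import Data.Vec as Vec using (Vec; []; _∷_; lookup)
open import Data.List as List using (List; []; _∷_; _++_; length; filter)
open import Data.List.Membership.Propositional using (_∈_)
open import Data.List.Relation.Unary.Unique.Propositional using (Unique)
open import Data.Product using (∃; Σ; _×_; _,_)
open import Data.Sum using (_⊎_)
open import Relation.Nullary using (Dec; yes; no; ¬_)
open import Relation.Nullary.Decidable using (⌊_⌋)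
open import Relation.Binary.PropositionalEquality using (_≡_)
open import Algebra.Structures using (IsCommutativeRing)

record FiniteField : Set₁ where
  field
    Carrier  : Set
    _+_ _*_  : Carrier → Carrier → Carrier
    -_       : Carrier → Carrier
    0# 1#    : Carrier
    _⁻¹      : Carrier → Carrier          -- value at 0 is irrelevant
    isCommutativeRing : IsCommutativeRing _≡_ _+_ _*_ -_ 0# 1#
    0≢1      : ¬ (0# ≡ 1#)
    inverseʳ : ∀ x → ¬ (x ≡ 0#) → (x * (x ⁻¹)) ≡ 1#
    _≟_      : (x y : Carrier) → Dec (x ≡ y)
    elements : List Carrier
    complete : ∀ x → x ∈ elements
    unique   : Unique elements
    p r      : ℕ
    p-prime  : Prime p
    p-odd    : ¬ (p ≡ 2)
    r≥1      : 1 ≤ r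
    size     : length elements ≡ p ^ r

module FF (F : FiniteField) where
  open FiniteField F public

  q : ℕ
  q = p ^ r

  pow : Carrier → ℕ → Carrier
  pow x zero    = 1#
  pow x (suc n) = x * pow x n

  ι : ℕ → Carrier
  ι zero    = 0#
  ι (suc n) = 1# + ι n

  Tr : Carrier → Carrier
  Tr c = go r
    where
    go : ℕ → Carrier
    go zero    = 0#
    go (suc k) = pow c (p ^ k) + go k

  -- the integer t ∈ {0..p-1} with t·1 = Tr(c) (Tr(c) lies in the prime field)
  trℕ : Carrier → ℕ
  trℕ c = search (List.upTo p)
    where
    search : List ℕ → ℕ
    search []       = 0
    search (t ∷ ts) with ι t ≟ Tr c
    ... | yes _ = t
    ... | no  _ = search ts

  -- quadratic character η (only used at nonzero arguments)
  isSquare : Carrier → Bool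
  isSquare c = any (λ y → ⌊ (y * y) ≟ c ⌋) elements

  η : Carrier → ℤ
  η c = if isSquare c then + 1 else ℤ.- (+ 1)

-- The ring Z[ζ_n] ⊂ ℂ, ζ_n = e^{2πi/n}, realised as the group ring
-- Z[C_n] = Z[x]/(x^n - 1) (coefficient functions Fin n → ℤ) modulo the
-- kernel of x ↦ ζ_n, which for n prime is exactly the constant vectors.

Zζ : ℕ → Set
Zζ n = Fin n → ℤ

module Cyc (n : ℕ) where

  sumFin : ∀ {k} → (Fin k → ℤ) → ℤ
  sumFin {zero}  f = + 0
  sumFin {suc k} f = f Fin.zero ℤ.+ sumFin (λ i → f (Fin.suc i))

  _≈_ : Zζ n → Zζ n → Set
  a ≈ b = ∃ λ (c : ℤ) → ∀ k → (a k ℤ.- b k) ≡ c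

  _⊕_ : Zζ n → Zζ n → Zζ n
  (a ⊕ b) k = a k ℤ.+ b k

  -- cyclic convolution (multiplication, ζ^i ζ^j = ζ^(i+j mod n))
  _⊗_ : Zζ n → Zζ n → Zζ n
  (a ⊗ b) k = sumFin λ i → sumFin λ j →
    (if ⌊ (toℕ i ℕ.+ toℕ j) ℕ.≟ toℕ k ⌋ ∨ ⌊ (toℕ i ℕ.+ toℕ j) ℕ.≟ (toℕ k ℕ.+ n) ⌋
     then a i ℤ.* b j else + 0)
    where open import Data.Bool using (_∨_)

  zeroζ : Zζ n
  zeroζ _ = + 0

  ζ^ : ℕ → Zζ n
  ζ^ t k = if ⌊ toℕ k ℕ.≟ t ⌋ then + 1 else + 0

  ⟦_⟧ : ℤ → Zζ n
  ⟦ z ⟧ k = if ⌊ toℕ k ℕ.≟ 0 ⌋ then z else + 0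

  oneζ : Zζ n
  oneζ = ⟦ + 1 ⟧

  _⊝_ : Zζ n → Zζ n → Zζ n
  (a ⊝ b) k = a k ℤ.- b k

  ΣL : ∀ {A : Set} → List A → (A → Zζ n) → Zζ n
  ΣL []       f = zeroζ
  ΣL (x ∷ xs) f = f x ⊕ ΣL xs f

  ΠFin : ∀ {k} → (Fin k → Zζ n) → Zζ n
  ΠFin {zero}  f = oneζ
  ΠFin {suc k} f = f Fin.zero ⊗ ΠFin (λ i → f (Fin.suc i))

allSubsets : (d : ℕ) → List (Subset d)
allSubsets zero    = [] ∷ []
allSubsets (suc d) = List.map (inside ∷_) (allSubsets d) ++ List.map (outside ∷_) (allSubsets d)

module Setup (F : FiniteField) where
  open FF F public
  open Cyc p public

  allVecs : (d : ℕ) → List (Vec Carrier d)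
  allVecs zero    = [] ∷ []
  allVecs (suc d) = List.concatMap (λ x → List.map (x ∷_) (allVecs d)) elements

  χ₁ : Carrier → Zζ p
  χ₁ c = ζ^ (trℕ c)

  G₁ : Zζ p
  G₁ = ΣL elements (λ c → if ⌊ c ≟ 0# ⌋ then zeroζ else (⟦ η c ⟧ ⊗ χ₁ c))

  ‖_‖ : ∀ {d} → Vec Carrier d → Carrier
  ‖ [] ‖     = 0#
  ‖ x ∷ xs ‖ = (x * x) + ‖ xs ‖

  _·_ : ∀ {d} → Vec Carrier d → Vec Carrier d → Carrier
  [] · []             = 0#
  (m ∷ ms) · (x ∷ xs) = (m * x) + (ms · xs)

  𝒵 : ∀ {d} → Vec Carrier d → ℕ
  𝒵 x = length (filter (λ c → c ≟ 0#) (Vec.toList x))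

  𝒵ᵢ : ∀ {d} → Vec Carrier d → Subset d → ℕ
  𝒵ᵢ []       []            = 0
  𝒵ᵢ (m ∷ ms) (true  ∷ I)   = (if ⌊ m ≟ 0# ⌋ then 1 else 0) ℕ.+ 𝒵ᵢ ms I
  𝒵ᵢ (m ∷ ms) (false ∷ I)   = 𝒵ᵢ ms I

  N : (d α : ℕ) → List (Vec Carrier d)
  N d α = filter (λ x → 𝒵 x ℕ.≟ α) (allVecs d)

  subsetsOfSize : (d k : ℕ) → List (Subset d)
  subsetsOfSize d k = filter (λ I → ∣ I ∣ ℕ.≟ k) (allSubsets d)

  four : Carrier
  four = ι 4

  LHS : ∀ {d} → Vec Carrier d → ℕ → Carrier → Zζ p
  LHS {d} m α s = ΣL (N d α) (λ x → χ₁ ((s * ‖ x ‖) + (- (m · x))))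

  RHS≠0 : ∀ {d} → Vec Carrier d → ℕ → Carrier → Zζ p
  RHS≠0 {d} m α s = ΣL (subsetsOfSize d (d ℕ.∸ α)) λ I →
    ΠFin λ i → if ⌊ lookup I i Data.Bool.≟ true ⌋
      then ((⟦ η s ⟧ ⊗ G₁) ⊗ χ₁ (- ((lookup m i * lookup m i) * ((four * s) ⁻¹)))) ⊝ oneζ
      else oneζ
    where import Data.Bool

  RHS0 : ∀ {d} → Vec Carrier d → ℕ → Zζ p
  RHS0 {d} m α = ΣL (subsetsOfSize d (d ℕ.∸ α)) λ I →
    ⟦ ((+ q ℤ.- + 1) ℤ.^ 𝒵ᵢ m I) ℤ.* (ℤ.- (+ 1)) ℤ.^ (d ℕ.∸ α ℕ.∸ 𝒵ᵢ m I) ⟧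

-- Work in Z[ζ_p] modulo constants (Defs' _≈_). The additive character χ₁ is a homomorphism because Tr is
-- additive and lands in the prime field (the Frobenius-fixed points are the p roots ι 0, …, ι (p-1) of X^p - X),
-- and Σ_c χ₁ (a c) ≈ 0 for a ≠ 0 because translating c by a⁻¹ e₁, where Tr e₁ = 1, multiplies the sum by ζ.
-- The summand χ₁ (s‖x‖ - m·x) factors over the coordinates, so the sum over x ∈ N_α becomes a sum over the
-- supports I of x, |I| = d - α, of products of the one-coordinate sums Σ_{c ≠ 0} χ₁ (s c² - m_i c).
-- For s ≠ 0, completing the square turns such a sum into η(s) G₁ χ₁ (-m_i²/4s) - 1, by the Gauss sum
-- Σ_y χ₁ (s y²) ≈ η(s) G₁; the latter follows from counting square roots (x ≠ 0 has 1 + η(x) of them) and the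
-- multiplicativity of η. For s = 0 the sum is Σ_{c ≠ 0} χ₁ (-m_i c), i.e. q - 1 if m_i = 0 and -1 otherwise.
module Submission where

open import Level using (0ℓ)
open import Algebra.Bundles using (CommutativeRing; CommutativeSemigroup)
open import Algebra.Structures using (IsCommutativeMonoid; IsCommutativeRing)
import Algebra.Properties.CommutativeSemigroup as CommutativeSemigroupProperties
import Algebra.Properties.CommutativeSemiring.Binomial as BinomialProperties
import Algebra.Properties.Ring as RingProperties
import Algebra.Solver.Ring as RingSolver
import Algebra.Solver.Ring.AlmostCommutativeRing as ACR
open import Data.Bool as Bool using (Bool; true; false; if_then_else_; T)
import Data.Bool.Properties as BoolP
open import Data.Empty using (⊥; ⊥-elim)
open import Data.Fin as Fin using (Fin; toℕ; fromℕ<)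
import Data.Fin.Properties as FinP
open import Data.Fin.Subset using (Subset; inside; outside; ∣_∣)
open import Data.Integer as ℤ using (ℤ; -[1+_])
import Data.Integer.Properties as ℤP
open import Data.Integer.Solver using (module +-*-Solver)
open import Data.List using (List; []; _∷_; _++_; map; concatMap; filter; length; allFin; tabulate; replicate; upTo)
open import Data.List.Properties using (length-replicate; length-++)
open import Data.List.Membership.Propositional using (_∈_; find; lose)
open import Data.List.Membership.Propositional.Properties using (∈-allFin; ∈-upTo⁺; ∈-upTo⁻)
open import Data.List.Relation.Unary.All as All using (All; []; _∷_; all?)
open import Data.List.Relation.Unary.All.Properties using (¬All⇒Any¬)
open import Data.List.Relation.Unary.AllPairs using ([]; _∷_)
open import Data.List.Relation.Unary.Any using (here; there; any?; satisfied)
open import Data.List.Relation.Unary.Any.Properties using (any⁺; any⁻)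
open import Data.List.Relation.Unary.Unique.Propositional using (Unique)
open import Data.List.Relation.Unary.Unique.Propositional.Properties using (allFin⁺)
open import Data.Maybe as Maybe using (Maybe)
open import Data.Nat as ℕ using (ℕ; zero; suc; _≤_; _<_; z≤n; s≤s)
open import Data.Nat.Base using (nonTrivial⇒n>1)
open import Data.Nat.Combinatorics using (_C_; nCk≡n!/k![n-k]!; k![n∸k]!∣n!; nCn≡1)
open import Data.Nat.Coprimality using (Coprime; coprime⇒GCD≡1)
open import Data.Nat.Divisibility as Div using (_∣_; divides)
open import Data.Nat.DivMod using (m/n*n≡m)
open import Data.Nat.GCD using (module Bézout)
open import Data.Nat.Primality using (prime⇒irreducible; prime⇒nonTrivial; euclidsLemma)
import Data.Nat.Properties as ℕP
open import Data.Product using (_×_; _,_; proj₁; proj₂; Σ-syntax)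
import Data.Sign as Sign
open import Data.Sum using (_⊎_; inj₁; inj₂)
open import Data.Vec using (Vec; []; _∷_; lookup)
open import Function using (_∘_)
open import Function.Bundles using (Equivalence; _⇔_; mk⇔)
open import Relation.Binary.Bundles using (Setoid)
open import Relation.Binary.Definitions using (DecidableEquality; tri<; tri≈; tri>)
import Relation.Binary.Reasoning.Setoid as SetoidReasoning
open import Relation.Binary.PropositionalEquality
open import Relation.Nullary using (Dec; yes; no; ¬_; does)
open import Relation.Nullary.Decidable as Decidable using (⌊_⌋)
open import Defs

module ListSum {A : Set} {_∙_ : A → A → A} {ε : A} (isCM : IsCommutativeMonoid _≡_ _∙_ ε) where
  open IsCommutativeMonoid isCM using (assoc; identityˡ; identityʳ; isCommutativeSemigroup)

  commutativeSemigroup : CommutativeSemigroup 0ℓ 0ℓ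
  commutativeSemigroup = record { isCommutativeSemigroup = isCommutativeSemigroup }

  open CommutativeSemigroupProperties commutativeSemigroup using (interchange; x∙yz≈y∙xz)

  Σ : {X : Set} → List X → (X → A) → A
  Σ []       f = ε
  Σ (x ∷ xs) f = f x ∙ Σ xs f

  Σ-cong : {X : Set} (xs : List X) {f g : X → A} → (∀ x → f x ≡ g x) → Σ xs f ≡ Σ xs g
  Σ-cong []       e = refl
  Σ-cong (x ∷ xs) e = cong₂ _∙_ (e x) (Σ-cong xs e)

  Σ-congᴬ : {X : Set} {xs : List X} {f g : X → A} → All (λ x → f x ≡ g x) xs → Σ xs f ≡ Σ xs g
  Σ-congᴬ []       = refl
  Σ-congᴬ (e ∷ es) = cong₂ _∙_ e (Σ-congᴬ es)

  Σ-++ : {X : Set} (xs ys : List X) (f : X → A) → Σ (xs ++ ys) f ≡ Σ xs f ∙ Σ ys f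
  Σ-++ []       ys f = sym (identityˡ _)
  Σ-++ (x ∷ xs) ys f = trans (cong (f x ∙_) (Σ-++ xs ys f)) (sym (assoc _ _ _))

  Σ-map : {X Y : Set} (g : X → Y) (xs : List X) (f : Y → A) → Σ (map g xs) f ≡ Σ xs (f ∘ g)
  Σ-map g []       f = refl
  Σ-map g (x ∷ xs) f = cong (f (g x) ∙_) (Σ-map g xs f)

  Σ-concatMap : {X Y : Set} (g : X → List Y) (xs : List X) (f : Y → A) →
                Σ (concatMap g xs) f ≡ Σ xs (λ x → Σ (g x) f)
  Σ-concatMap g []       f = refl
  Σ-concatMap g (x ∷ xs) f =
    trans (Σ-++ (g x) (concatMap g xs) f) (cong (Σ (g x) f ∙_) (Σ-concatMap g xs f))

  Σ-ε : {X : Set} (xs : List X) → Σ xs (λ _ → ε) ≡ ε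
  Σ-ε []       = refl
  Σ-ε (x ∷ xs) = trans (identityˡ _) (Σ-ε xs)

  Σ-distrib : {X : Set} (xs : List X) (f g : X → A) → Σ xs (λ x → f x ∙ g x) ≡ Σ xs f ∙ Σ xs g
  Σ-distrib []       f g = sym (identityˡ ε)
  Σ-distrib (x ∷ xs) f g = trans (cong ((f x ∙ g x) ∙_) (Σ-distrib xs f g)) (interchange _ _ _ _)

  Σ-comm : {X Y : Set} (xs : List X) (ys : List Y) (f : X → Y → A) →
           Σ xs (λ x → Σ ys (f x)) ≡ Σ ys (λ y → Σ xs (λ x → f x y))
  Σ-comm []       ys f = sym (Σ-ε ys)
  Σ-comm (x ∷ xs) ys f = trans (cong (Σ ys (f x) ∙_) (Σ-comm xs ys f))
                               (sym (Σ-distrib ys (f x) (λ y → Σ xs (λ x′ → f x′ y))))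

  Σ-filter : {X : Set} {P : X → Set} (P? : ∀ x → Dec (P x)) (xs : List X) (f : X → A) →
             Σ (filter P? xs) f ≡ Σ xs (λ x → if does (P? x) then f x else ε)
  Σ-filter P? []       f = refl
  Σ-filter P? (x ∷ xs) f with does (P? x)
  ... | true  = cong (f x ∙_) (Σ-filter P? xs f)
  ... | false = trans (Σ-filter P? xs f) (sym (identityˡ _))

  module _ {X : Set} (_≟_ : DecidableEquality X) where

    omit : X → (X → A) → X → A
    omit a f x = if does (x ≟ a) then ε else f x

    omit-≢ : ∀ {a x} (f : X → A) → ¬ x ≡ a → omit a f x ≡ f x
    omit-≢ {a} {x} f x≢a with x ≟ a
    ... | yes x≡a = ⊥-elim (x≢a x≡a)
    ... | no _    = refl

    Σ-extract : (xs : List X) → Unique xs → (a : X) → a ∈ xs → (f : X → A) →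
                Σ xs f ≡ f a ∙ Σ xs (omit a f)
    Σ-extract (y ∷ ys) (y∉ys ∷ _) a (here refl) f with y ≟ y
    ... | no y≢y = ⊥-elim (y≢y refl)
    ... | yes _  = cong (f y ∙_) (trans (Σ-congᴬ (All.map unchanged y∉ys)) (sym (identityˡ _)))
      where
      unchanged : ∀ {x} → ¬ y ≡ x → f x ≡ omit y f x
      unchanged {x} y≢x with x ≟ y
      ... | yes x≡y = ⊥-elim (y≢x (sym x≡y))
      ... | no _    = refl
    Σ-extract (y ∷ ys) (y∉ys ∷ u) a (there a∈ys) f with y ≟ a
    ... | yes refl = ⊥-elim (All.lookup y∉ys a∈ys refl)
    ... | no _     = trans (cong (f y ∙_) (Σ-extract ys u a a∈ys f)) (x∙yz≈y∙xz _ _ _)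

    Σ-indicator : (xs : List X) → Unique xs → (a : X) → a ∈ xs → (g : X → A) →
                  Σ xs (λ x → if does (x ≟ a) then g x else ε) ≡ g a
    Σ-indicator xs u a a∈xs g = begin
      Σ xs G                  ≡⟨ Σ-extract xs u a a∈xs G ⟩
      G a ∙ Σ xs (omit a G)   ≡⟨ cong₂ _∙_ Ga≡ga (trans (Σ-cong xs omitted) (Σ-ε xs)) ⟩
      g a ∙ ε                 ≡⟨ identityʳ _ ⟩
      g a                     ∎
      where
      open ≡-Reasoning
      G : X → A
      G x = if does (x ≟ a) then g x else ε
      Ga≡ga : G a ≡ g a
      Ga≡ga with a ≟ a
      ... | yes _  = refl
      ... | no a≢a = ⊥-elim (a≢a refl)
      omitted : ∀ x → omit a G x ≡ ε
      omitted x with x ≟ a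
      ... | yes _ = refl
      ... | no _  = refl

    module Enumeration (xs : List X) (complete : ∀ x → x ∈ xs) (unique : Unique xs) where

      ΣX : (X → A) → A
      ΣX = Σ xs

      ΣX-extract : (a : X) (f : X → A) → ΣX f ≡ f a ∙ ΣX (omit a f)
      ΣX-extract a = Σ-extract xs unique a (complete a)

      ΣX-indicator : (a : X) (g : X → A) → ΣX (λ x → if does (x ≟ a) then g x else ε) ≡ g a
      ΣX-indicator a = Σ-indicator xs unique a (complete a)

      ΣX-reindex : (σ τ : X → X) → (∀ x → τ (σ x) ≡ x) → (∀ y → σ (τ y) ≡ y) →
                   (f : X → A) → ΣX (f ∘ σ) ≡ ΣX f
      ΣX-reindex σ τ τσ στ f = begin
        ΣX (f ∘ σ)
          ≡⟨ Σ-cong xs (λ x → sym (ΣX-indicator (σ x) f)) ⟩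
        ΣX (λ x → ΣX (λ y → if does (y ≟ σ x) then f y else ε))
          ≡⟨ Σ-comm xs xs _ ⟩
        ΣX (λ y → ΣX (λ x → if does (y ≟ σ x) then f y else ε))
          ≡⟨ Σ-cong xs (λ y → Σ-cong xs (λ x → same-condition y x)) ⟩
        ΣX (λ y → ΣX (λ x → if does (x ≟ τ y) then f y else ε))
          ≡⟨ Σ-cong xs (λ y → ΣX-indicator (τ y) (λ _ → f y)) ⟩
        ΣX f ∎
        where
        open ≡-Reasoning
        same-condition : ∀ y x → (if does (y ≟ σ x) then f y else ε) ≡ (if does (x ≟ τ y) then f y else ε)
        same-condition y x with y ≟ σ x | x ≟ τ y
        ... | yes _    | yes _    = refl
        ... | no _     | no _     = refl
        ... | yes y≡σx | no x≢τy  = ⊥-elim (x≢τy (trans (sym (τσ x)) (cong τ (sym y≡σx))))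
        ... | no y≢σx  | yes x≡τy = ⊥-elim (y≢σx (trans (sym (στ y)) (cong σ (sym x≡τy))))

module ℤSum = ListSum ℤP.+-0-isCommutativeMonoid
open ℤSum using () renaming (Σ to Σℤ)

module IntegerSums where
  open import Data.Integer.Base using (+_)

  Σℤ-*ˡ : {X : Set} (xs : List X) (c : ℤ) (f : X → ℤ) → Σℤ xs (λ x → c ℤ.* f x) ≡ c ℤ.* Σℤ xs f
  Σℤ-*ˡ []       c f = sym (ℤP.*-zeroʳ c)
  Σℤ-*ˡ (x ∷ xs) c f = trans (cong (ℤ._+_ (c ℤ.* f x)) (Σℤ-*ˡ xs c f)) (sym (ℤP.*-distribˡ-+ c (f x) _))

  Σℤ-*ʳ : {X : Set} (xs : List X) (f : X → ℤ) (c : ℤ) → Σℤ xs (λ x → f x ℤ.* c) ≡ Σℤ xs f ℤ.* c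
  Σℤ-*ʳ xs f c = trans (ℤSum.Σ-cong xs (λ x → ℤP.*-comm (f x) c)) (trans (Σℤ-*ˡ xs c f) (ℤP.*-comm c _))

  Σℤ-neg : {X : Set} (xs : List X) (f : X → ℤ) → Σℤ xs (λ x → ℤ.- f x) ≡ ℤ.- Σℤ xs f
  Σℤ-neg []       f = refl
  Σℤ-neg (x ∷ xs) f = trans (cong (ℤ._+_ (ℤ.- f x)) (Σℤ-neg xs f)) (sym (ℤP.neg-distrib-+ (f x) _))

  Σℤ-const : {X : Set} (xs : List X) (c : ℤ) → Σℤ xs (λ _ → c) ≡ + length xs ℤ.* c
  Σℤ-const []       c = refl
  Σℤ-const (x ∷ xs) c = begin
    c ℤ.+ Σℤ xs (λ _ → c)              ≡⟨ cong₂ ℤ._+_ (sym (ℤP.*-identityˡ c)) (Σℤ-const xs c) ⟩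
    + 1 ℤ.* c ℤ.+ + length xs ℤ.* c    ≡⟨ sym (ℤP.*-distribʳ-+ c (+ 1) (+ length xs)) ⟩
    + length (x ∷ xs) ℤ.* c            ∎
    where open ≡-Reasoning

  Σℤ-nonpositive : {X : Set} (xs : List X) (f : X → ℤ) → (∀ x → f x ℤ.≤ + 0) → Σℤ xs f ℤ.≤ + 0
  Σℤ-nonpositive []       f f≤0 = ℤP.≤-refl
  Σℤ-nonpositive (x ∷ xs) f f≤0 = ℤP.+-mono-≤ (f≤0 x) (Σℤ-nonpositive xs f f≤0)

  Σℤ-nonpositive-zero : {X : Set} (xs : List X) (f : X → ℤ) → (∀ x → f x ℤ.≤ + 0) →
                        Σℤ xs f ≡ + 0 → ∀ {x} → x ∈ xs → f x ≡ + 0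
  Σℤ-nonpositive-zero (y ∷ ys) f f≤0 Σ≡0 (here refl) = ℤP.≤-antisym (f≤0 y) (begin
    + 0              ≡⟨ sym Σ≡0 ⟩
    f y ℤ.+ Σℤ ys f  ≤⟨ ℤP.+-monoʳ-≤ (f y) (Σℤ-nonpositive ys f f≤0) ⟩
    f y ℤ.+ + 0      ≡⟨ ℤP.+-identityʳ (f y) ⟩
    f y              ∎)
    where open ℤP.≤-Reasoning
  Σℤ-nonpositive-zero (y ∷ ys) f f≤0 Σ≡0 (there x∈ys) =
    Σℤ-nonpositive-zero ys f f≤0 Σys≡0 x∈ys
    where
    Σys≡0 : Σℤ ys f ≡ + 0
    Σys≡0 = trans (sym (ℤP.+-identityˡ _))
              (trans (cong (ℤ._+ Σℤ ys f) (sym (Σℤ-nonpositive-zero (y ∷ ys) f f≤0 Σ≡0 (here refl)))) Σ≡0)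
open IntegerSums

module Cyclotomic (n : ℕ) (2≤n : 2 ≤ n) where
  open Cyc n
  open import Data.Integer.Base using (+_)
  open import Data.Bool using (_∨_)

  ≗-setoid : Setoid 0ℓ 0ℓ
  ≗-setoid = record
    { Carrier       = Zζ n
    ; _≈_           = _≗_
    ; isEquivalence = record { refl = λ _ → refl ; sym = λ e k → sym (e k) ; trans = λ e e′ k → trans (e k) (e′ k) }
    }

  module ≗-Reasoning = SetoidReasoning ≗-setoid

  module FinSum {k : ℕ} = ℤSum.Enumeration (FinP._≟_ {k}) (allFin k) ∈-allFin (allFin⁺ k)

  sumFin≡Σℤ : ∀ {k} (g : Fin k → ℤ) → sumFin g ≡ Σℤ (allFin k) g
  sumFin≡Σℤ g = sym (Σℤ-tabulate _ (λ i → i) g)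
    where
    Σℤ-tabulate : ∀ {A : Set} m (h : Fin m → A) (g : A → ℤ) → Σℤ (tabulate h) g ≡ sumFin (g ∘ h)
    Σℤ-tabulate zero    h g = refl
    Σℤ-tabulate (suc m) h g = cong (ℤ._+_ (g (h Fin.zero))) (Σℤ-tabulate m (h ∘ Fin.suc) g)

  sumFin-cong : ∀ {k} {f g : Fin k → ℤ} → f ≗ g → sumFin f ≡ sumFin g
  sumFin-cong {zero}  e = refl
  sumFin-cong {suc k} e = cong₂ ℤ._+_ (e Fin.zero) (sumFin-cong (e ∘ Fin.suc))

  sumFin-+ : ∀ {k} (f g : Fin k → ℤ) → sumFin (λ i → f i ℤ.+ g i) ≡ sumFin f ℤ.+ sumFin g
  sumFin-+ {k} f g = trans (sumFin≡Σℤ (λ i → f i ℤ.+ g i))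
    (trans (ℤSum.Σ-distrib (allFin k) f g) (sym (cong₂ ℤ._+_ (sumFin≡Σℤ f) (sumFin≡Σℤ g))))

  sumFin-*ˡ : ∀ {k} (c : ℤ) (f : Fin k → ℤ) → sumFin (λ i → c ℤ.* f i) ≡ c ℤ.* sumFin f
  sumFin-*ˡ {k} c f = trans (sumFin≡Σℤ (λ i → c ℤ.* f i)) (trans (Σℤ-*ˡ (allFin k) c f) (cong (c ℤ.*_) (sym (sumFin≡Σℤ f))))

  sumFin-− : ∀ {k} (f g : Fin k → ℤ) → sumFin f ℤ.- sumFin g ≡ sumFin (λ i → f i ℤ.- g i)
  sumFin-− {k} f g = sym (begin
    sumFin (λ i → f i ℤ.- g i)               ≡⟨ sumFin-+ f (λ i → ℤ.- g i) ⟩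
    sumFin f ℤ.+ sumFin (λ i → ℤ.- g i)      ≡⟨ cong (ℤ._+_ (sumFin f)) (sumFin≡Σℤ (ℤ.-_ ∘ g)) ⟩
    sumFin f ℤ.+ Σℤ (allFin k) (ℤ.-_ ∘ g)    ≡⟨ cong (ℤ._+_ (sumFin f)) (Σℤ-neg (allFin k) g) ⟩
    sumFin f ℤ.- Σℤ (allFin k) g             ≡⟨ cong (λ x → sumFin f ℤ.- x) (sym (sumFin≡Σℤ g)) ⟩
    sumFin f ℤ.- sumFin g                    ∎)
    where open ≡-Reasoning

  sumFin-zero : ∀ {k} → sumFin {k} (λ _ → + 0) ≡ + 0
  sumFin-zero {k} = trans (sumFin≡Σℤ {k} (λ _ → + 0)) (ℤSum.Σ-ε (allFin k))

  sumFin-comm : ∀ {k l} (f : Fin k → Fin l → ℤ) →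
                sumFin (λ i → sumFin (λ j → f i j)) ≡ sumFin (λ j → sumFin (λ i → f i j))
  sumFin-comm {k} {l} f = begin
    sumFin (λ i → sumFin (f i))                          ≡⟨ sumFin≡Σℤ (λ i → sumFin (f i)) ⟩
    Σℤ (allFin k) (λ i → sumFin (f i))                   ≡⟨ ℤSum.Σ-cong (allFin k) (λ i → sumFin≡Σℤ (f i)) ⟩
    Σℤ (allFin k) (λ i → Σℤ (allFin l) (f i))            ≡⟨ ℤSum.Σ-comm (allFin k) (allFin l) f ⟩
    Σℤ (allFin l) (λ j → Σℤ (allFin k) (λ i → f i j))    ≡⟨ ℤSum.Σ-cong (allFin l) (λ j → sym (sumFin≡Σℤ (λ i → f i j))) ⟩
    Σℤ (allFin l) (λ j → sumFin (λ i → f i j))           ≡⟨ sym (sumFin≡Σℤ (λ j → sumFin (λ i → f i j))) ⟩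
    sumFin (λ j → sumFin (λ i → f i j))                  ∎
    where open ≡-Reasoning

  sumFin-indicator : ∀ {k} (a : Fin k) (c : Fin k → Bool) → (∀ i → c i ≡ does (i Fin.≟ a)) →
                     (g : Fin k → ℤ) → sumFin (λ i → if c i then g i else + 0) ≡ g a
  sumFin-indicator {k} a c c≡ g = begin
    sumFin (λ i → if c i then g i else + 0)                     ≡⟨ sumFin-cong (λ i → cong (λ b → if b then g i else + 0) (c≡ i)) ⟩
    sumFin (λ i → if does (i Fin.≟ a) then g i else + 0)        ≡⟨ sumFin≡Σℤ (λ i → if does (i Fin.≟ a) then g i else + 0) ⟩
    Σℤ (allFin k) (λ i → if does (i Fin.≟ a) then g i else + 0) ≡⟨ FinSum.ΣX-indicator a g ⟩
    g a                                                         ∎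
    where open ≡-Reasoning

  -- For i, j, k < n this says i + j ≡ k (mod n): the sum either equals k or overflows it by n.
  data SumMod (i j k : ℕ) : Set where
    exact    : i ℕ.+ j ≡ k → SumMod i j k
    overflow : i ℕ.+ j ≡ k ℕ.+ n → SumMod i j k

  SumMod-injective : ∀ {i j j′ k} → j < n → j′ < n → SumMod i j k → SumMod i j′ k → j ≡ j′
  SumMod-injective _ _ (exact e) (exact e′) = ℕP.+-cancelˡ-≡ _ _ _ (trans e (sym e′))
  SumMod-injective _ _ (overflow e) (overflow e′) = ℕP.+-cancelˡ-≡ _ _ _ (trans e (sym e′))
  SumMod-injective {i} {j} {j′} {k} j<n j′<n (exact e) (overflow e′) = ⊥-elim (ℕP.<-irrefl refl (begin-strict
    i ℕ.+ j′          <⟨ ℕP.+-monoʳ-< i j′<n ⟩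
    i ℕ.+ n           ≤⟨ ℕP.+-monoʳ-≤ i (ℕP.m≤n+m n j) ⟩
    i ℕ.+ (j ℕ.+ n)   ≡⟨ sym (ℕP.+-assoc i j n) ⟩
    i ℕ.+ j ℕ.+ n     ≡⟨ cong (ℕ._+ n) e ⟩
    k ℕ.+ n           ≡⟨ sym e′ ⟩
    i ℕ.+ j′          ∎))
    where open ℕP.≤-Reasoning
  SumMod-injective j<n j′<n (overflow e) (exact e′) = sym (SumMod-injective j′<n j<n (exact e′) (overflow e))

  SumMod-functional : ∀ {i j k k′} → k < n → k′ < n → SumMod i j k → SumMod i j k′ → k ≡ k′
  SumMod-functional _ _ (exact e) (exact e′) = trans (sym e) e′
  SumMod-functional _ _ (overflow e) (overflow e′) = ℕP.+-cancelʳ-≡ _ _ _ (trans (sym e) e′)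
  SumMod-functional {k = k} {k′} k<n k′<n (exact e) (overflow e′) = ⊥-elim (ℕP.<-irrefl refl
    (ℕP.<-≤-trans k<n (ℕP.≤-trans (ℕP.m≤n+m n k′) (ℕP.≤-reflexive (trans (sym e′) e)))))
  SumMod-functional {i} {j} k<n k′<n (overflow e) (exact e′) =
    sym (SumMod-functional {i} {j} k′<n k<n (exact e′) (overflow e))

  SumMod-solvable : ∀ i k → i < n → k < n → Σ[ j ∈ ℕ ] (j < n × SumMod i j k)
  SumMod-solvable i k i<n k<n with i ℕP.≤? k
  ... | yes i≤k = k ℕ.∸ i , ℕP.≤-<-trans (ℕP.m∸n≤m k i) k<n , exact (ℕP.m+[n∸m]≡n i≤k)
  ... | no i≰k  = (k ℕ.+ n) ℕ.∸ i , j<n , overflow i+j≡k+n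
    where
    i+j≡k+n : i ℕ.+ ((k ℕ.+ n) ℕ.∸ i) ≡ k ℕ.+ n
    i+j≡k+n = ℕP.m+[n∸m]≡n (ℕP.≤-trans (ℕP.<⇒≤ i<n) (ℕP.m≤n+m n k))
    j<n : (k ℕ.+ n) ℕ.∸ i < n
    j<n = ℕP.+-cancelˡ-< i _ _ (subst (ℕ._< i ℕ.+ n) (sym i+j≡k+n) (ℕP.+-monoˡ-< n (ℕP.≰⇒> i≰k)))

  infixl 6 _⊖_
  _⊖_ : Fin n → Fin n → Fin n
  k ⊖ i = fromℕ< (proj₁ (proj₂ (SumMod-solvable (toℕ i) (toℕ k) (FinP.toℕ<n i) (FinP.toℕ<n k))))

  ⊖-SumMod : ∀ k i → SumMod (toℕ i) (toℕ (k ⊖ i)) (toℕ k)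
  ⊖-SumMod k i with SumMod-solvable (toℕ i) (toℕ k) (FinP.toℕ<n i) (FinP.toℕ<n k)
  ... | j , j<n , sum rewrite FinP.toℕ-fromℕ< j<n = sum

  SumMod⇒≡⊖ : ∀ k i j → SumMod (toℕ i) (toℕ j) (toℕ k) → j ≡ k ⊖ i
  SumMod⇒≡⊖ k i j sum = FinP.toℕ-injective
    (SumMod-injective (FinP.toℕ<n j) (FinP.toℕ<n (k ⊖ i)) sum (⊖-SumMod k i))

  sumsTo : Fin n → Fin n → Fin n → Bool
  sumsTo i j k = ⌊ toℕ i ℕ.+ toℕ j ℕ.≟ toℕ k ⌋ ∨ ⌊ toℕ i ℕ.+ toℕ j ℕ.≟ toℕ k ℕ.+ n ⌋

  sumsTo≡≟⊖ : ∀ i j k → sumsTo i j k ≡ does (j Fin.≟ k ⊖ i)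
  sumsTo≡≟⊖ i j k with toℕ i ℕ.+ toℕ j ℕ.≟ toℕ k | toℕ i ℕ.+ toℕ j ℕ.≟ toℕ k ℕ.+ n | j Fin.≟ k ⊖ i
  ... | yes _ | _     | yes _ = refl
  ... | no _  | yes _ | yes _ = refl
  ... | yes e | _     | no j≢ = ⊥-elim (j≢ (SumMod⇒≡⊖ k i j (exact e)))
  ... | no _  | yes e | no j≢ = ⊥-elim (j≢ (SumMod⇒≡⊖ k i j (overflow e)))
  ... | no ¬e | no ¬e′ | yes refl with ⊖-SumMod k i
  ...   | exact e = ⊥-elim (¬e e)
  ...   | overflow e = ⊥-elim (¬e′ e)
  sumsTo≡≟⊖ i j k | no _ | no _ | no _ = refl

  sumsTo-comm : ∀ i j k → sumsTo i j k ≡ sumsTo j i k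
  sumsTo-comm i j k rewrite ℕP.+-comm (toℕ i) (toℕ j) = refl

  ⊗-sumˡ : ∀ a b k → (a ⊗ b) k ≡ sumFin (λ i → a i ℤ.* b (k ⊖ i))
  ⊗-sumˡ a b k = sumFin-cong (λ i →
    sumFin-indicator (k ⊖ i) (λ j → sumsTo i j k) (λ j → sumsTo≡≟⊖ i j k) (λ j → a i ℤ.* b j))

  ⊗-sumʳ : ∀ a b k → (a ⊗ b) k ≡ sumFin (λ j → a (k ⊖ j) ℤ.* b j)
  ⊗-sumʳ a b k = trans (sumFin-comm (λ i j → if sumsTo i j k then a i ℤ.* b j else + 0))
    (sumFin-cong (λ j → sumFin-indicator (k ⊖ j) (λ i → sumsTo i j k)
                          (λ i → trans (sumsTo-comm i j k) (sumsTo≡≟⊖ j i k)) (λ i → a i ℤ.* b j)))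

  ⊗-comm : ∀ a b → a ⊗ b ≗ b ⊗ a
  ⊗-comm a b k = trans (⊗-sumˡ a b k)
    (trans (sumFin-cong (λ i → ℤP.*-comm (a i) (b (k ⊖ i)))) (sym (⊗-sumʳ b a k)))

  ⊗-congˡ : ∀ {a a′} b → a ≗ a′ → a ⊗ b ≗ a′ ⊗ b
  ⊗-congˡ {a} {a′} b e k = trans (⊗-sumˡ a b k)
    (trans (sumFin-cong (λ i → cong (ℤ._* b (k ⊖ i)) (e i))) (sym (⊗-sumˡ a′ b k)))

  ⊗-congʳ : ∀ a {b b′} → b ≗ b′ → a ⊗ b ≗ a ⊗ b′
  ⊗-congʳ a {b} {b′} e k = trans (⊗-comm a b k) (trans (⊗-congˡ a e k) (⊗-comm b′ a k))

  ⊗-distribʳ : ∀ a b c → (a ⊕ b) ⊗ c ≗ (a ⊗ c) ⊕ (b ⊗ c)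
  ⊗-distribʳ a b c k = begin
    ((a ⊕ b) ⊗ c) k                                       ≡⟨ ⊗-sumˡ (a ⊕ b) c k ⟩
    sumFin (λ i → (a i ℤ.+ b i) ℤ.* c (k ⊖ i))            ≡⟨ sumFin-cong (λ i → ℤP.*-distribʳ-+ (c (k ⊖ i)) (a i) (b i)) ⟩
    sumFin (λ i → a i ℤ.* c (k ⊖ i) ℤ.+ b i ℤ.* c (k ⊖ i)) ≡⟨ sumFin-+ (λ i → a i ℤ.* c (k ⊖ i)) (λ i → b i ℤ.* c (k ⊖ i)) ⟩
    sumFin (λ i → a i ℤ.* c (k ⊖ i)) ℤ.+ sumFin (λ i → b i ℤ.* c (k ⊖ i))
                                                          ≡⟨ sym (cong₂ ℤ._+_ (⊗-sumˡ a c k) (⊗-sumˡ b c k)) ⟩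
    ((a ⊗ c) ⊕ (b ⊗ c)) k                                 ∎
    where open ≡-Reasoning

  ⊗-zeroˡ : ∀ a → zeroζ ⊗ a ≗ zeroζ
  ⊗-zeroˡ a k = trans (⊗-sumˡ zeroζ a k) (sumFin-zero {n})

  ⊗-zeroʳ : ∀ a → a ⊗ zeroζ ≗ zeroζ
  ⊗-zeroʳ a k = trans (⊗-comm a zeroζ k) (⊗-zeroˡ a k)

  toℕ≟≡≟fromℕ< : ∀ {t} (t<n : t < n) i → ⌊ toℕ i ℕ.≟ t ⌋ ≡ does (i Fin.≟ fromℕ< t<n)
  toℕ≟≡≟fromℕ< {t} t<n i with toℕ i ℕ.≟ t | i Fin.≟ fromℕ< t<n
  ... | yes _ | yes _    = refl
  ... | no _  | no _     = refl
  ... | yes e | no i≢t   = ⊥-elim (i≢t (FinP.toℕ-injective (trans e (sym (FinP.toℕ-fromℕ< t<n)))))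
  ... | no ¬e | yes refl = ⊥-elim (¬e (FinP.toℕ-fromℕ< t<n))

  -- z ζ^t; Defs' ζ^ t and ⟦ z ⟧ are monomials by definition.
  monomial : ℤ → ℕ → Zζ n
  monomial z t i = if ⌊ toℕ i ℕ.≟ t ⌋ then z else + 0

  monomial-⊗ : ∀ z {t} (t<n : t < n) a k → (monomial z t ⊗ a) k ≡ z ℤ.* a (k ⊖ fromℕ< t<n)
  monomial-⊗ z {t} t<n a k = begin
    (monomial z t ⊗ a) k                                     ≡⟨ ⊗-sumˡ (monomial z t) a k ⟩
    sumFin (λ i → monomial z t i ℤ.* a (k ⊖ i))              ≡⟨ sumFin-cong (λ i → if-* ⌊ toℕ i ℕ.≟ t ⌋ (a (k ⊖ i))) ⟩
    sumFin (λ i → if ⌊ toℕ i ℕ.≟ t ⌋ then z ℤ.* a (k ⊖ i) else + 0)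
                                                             ≡⟨ sumFin-indicator _ _ (toℕ≟≡≟fromℕ< t<n) (λ i → z ℤ.* a (k ⊖ i)) ⟩
    z ℤ.* a (k ⊖ fromℕ< t<n)                                 ∎
    where
    open ≡-Reasoning
    if-* : ∀ c b → (if c then z else + 0) ℤ.* b ≡ (if c then z ℤ.* b else + 0)
    if-* true  b = refl
    if-* false b = refl

  0<n : 0 < n
  0<n = ℕP.<-≤-trans (s≤s z≤n) 2≤n

  ⊖-identityʳ : ∀ k → k ⊖ fromℕ< 0<n ≡ k
  ⊖-identityʳ k = sym (SumMod⇒≡⊖ k (fromℕ< 0<n) k (exact (cong (ℕ._+ toℕ k) (FinP.toℕ-fromℕ< 0<n))))

  ⟦⟧-⊗ : ∀ z a → ⟦ z ⟧ ⊗ a ≗ (λ k → z ℤ.* a k)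
  ⟦⟧-⊗ z a k = trans (monomial-⊗ z 0<n a k) (cong (λ i → z ℤ.* a i) (⊖-identityʳ k))

  ⊗-identityˡ : ∀ a → oneζ ⊗ a ≗ a
  ⊗-identityˡ a k = trans (⟦⟧-⊗ (+ 1) a k) (ℤP.*-identityˡ (a k))

  ⟦⟧-⊗-⟦⟧ : ∀ x y → ⟦ x ⟧ ⊗ ⟦ y ⟧ ≗ ⟦ x ℤ.* y ⟧
  ⟦⟧-⊗-⟦⟧ x y k = trans (⟦⟧-⊗ x ⟦ y ⟧ k) scale
    where
    scale : x ℤ.* ⟦ y ⟧ k ≡ ⟦ x ℤ.* y ⟧ k
    scale with toℕ k ℕ.≟ 0
    ... | yes _ = refl
    ... | no _  = ℤP.*-zeroʳ x

  ⟦⟧-⊝ : ∀ x y → ⟦ x ⟧ ⊝ ⟦ y ⟧ ≗ ⟦ x ℤ.- y ⟧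
  ⟦⟧-⊝ x y k with toℕ k ℕ.≟ 0
  ... | yes _ = refl
  ... | no _  = refl

  ζ^-⊗-ζ^ : ∀ {t u w} → t < n → u < n → w < n → SumMod t u w → ζ^ t ⊗ ζ^ u ≗ ζ^ w
  ζ^-⊗-ζ^ {t} {u} {w} t<n u<n w<n t+u≡w k =
    trans (monomial-⊗ (+ 1) t<n (ζ^ u) k) (trans (ℤP.*-identityˡ _) shifted)
    where
    k⊖t : Fin n
    k⊖t = k ⊖ fromℕ< t<n
    t+k⊖t≡k : SumMod t (toℕ k⊖t) (toℕ k)
    t+k⊖t≡k = subst (λ i → SumMod i (toℕ k⊖t) (toℕ k)) (FinP.toℕ-fromℕ< t<n) (⊖-SumMod k (fromℕ< t<n))
    shifted : ζ^ u k⊖t ≡ ζ^ w k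
    shifted with toℕ k⊖t ℕ.≟ u | toℕ k ℕ.≟ w
    ... | yes _ | yes _ = refl
    ... | no _  | no _  = refl
    ... | yes e | no k≢w = ⊥-elim (k≢w (SumMod-functional (FinP.toℕ<n k) w<n
                                          (subst (λ j → SumMod t j (toℕ k)) e t+k⊖t≡k) t+u≡w))
    ... | no ¬e | yes e = ⊥-elim (¬e (SumMod-injective (FinP.toℕ<n k⊖t) u<n t+k⊖t≡k
                                          (subst (SumMod t u) (sym e) t+u≡w)))

  -- Defs' _≈_ as a record, so that both of its sides can be inferred.
  infix 4 _≃_
  record _≃_ (a b : Zζ n) : Set where
    constructor differ-by
    field
      offset     : ℤ
      difference : ∀ k → a k ℤ.- b k ≡ offset

  ≃⇒≈ : ∀ {a b} → a ≃ b → a ≈ b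
  ≃⇒≈ (differ-by c e) = c , e

  ≃-refl : ∀ {a} → a ≃ a
  ≃-refl {a} = differ-by (+ 0) (λ k → ℤP.+-inverseʳ (a k))

  ≗⇒≃ : ∀ {a b} → a ≗ b → a ≃ b
  ≗⇒≃ {a} e = differ-by (+ 0) (λ k → trans (cong (ℤ._-_ (a k)) (sym (e k))) (ℤP.+-inverseʳ (a k)))

  open +-*-Solver using (solve; _:+_; _:-_; _:*_; :-_; _:=_)

  ≃-trans : ∀ {a b c} → a ≃ b → b ≃ c → a ≃ c
  ≃-trans {a} {b} {c} (differ-by d e) (differ-by d′ e′) =
    differ-by (d ℤ.+ d′) (λ k → trans (telescope (a k) (b k) (c k)) (cong₂ ℤ._+_ (e k) (e′ k)))
    where
    telescope : ∀ x y z → x ℤ.- z ≡ (x ℤ.- y) ℤ.+ (y ℤ.- z)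
    telescope = solve 3 (λ x y z → x :- z := (x :- y) :+ (y :- z)) refl

  ≃-sym : ∀ {a b} → a ≃ b → b ≃ a
  ≃-sym {a} {b} (differ-by d e) = differ-by (ℤ.- d) (λ k → trans (swap (a k) (b k)) (cong ℤ.-_ (e k)))
    where
    swap : ∀ x y → y ℤ.- x ≡ ℤ.- (x ℤ.- y)
    swap = solve 2 (λ x y → y :- x := :- (x :- y)) refl

  ≃-setoid : Setoid 0ℓ 0ℓ
  ≃-setoid = record
    { Carrier       = Zζ n
    ; _≈_           = _≃_
    ; isEquivalence = record { refl = ≃-refl ; sym = ≃-sym ; trans = ≃-trans }
    }

  module ≃-Reasoning = SetoidReasoning ≃-setoid

  ⊕-≃ : ∀ {a a′ b b′} → a ≃ a′ → b ≃ b′ → a ⊕ b ≃ a′ ⊕ b′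
  ⊕-≃ {a} {a′} {b} {b′} (differ-by d e) (differ-by d′ e′) =
    differ-by (d ℤ.+ d′) (λ k → trans (rearrange (a k) (a′ k) (b k) (b′ k)) (cong₂ ℤ._+_ (e k) (e′ k)))
    where
    rearrange : ∀ x x′ y y′ → (x ℤ.+ y) ℤ.- (x′ ℤ.+ y′) ≡ (x ℤ.- x′) ℤ.+ (y ℤ.- y′)
    rearrange = solve 4 (λ x x′ y y′ → (x :+ y) :- (x′ :+ y′) := (x :- x′) :+ (y :- y′)) refl

  ⊝-≃ : ∀ {a a′ b b′} → a ≃ a′ → b ≃ b′ → a ⊝ b ≃ a′ ⊝ b′
  ⊝-≃ {a} {a′} {b} {b′} (differ-by d e) (differ-by d′ e′) =
    differ-by (d ℤ.- d′) (λ k → trans (rearrange (a k) (a′ k) (b k) (b′ k)) (cong₂ ℤ._-_ (e k) (e′ k)))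
    where
    rearrange : ∀ x x′ y y′ → (x ℤ.- y) ℤ.- (x′ ℤ.- y′) ≡ (x ℤ.- x′) ℤ.- (y ℤ.- y′)
    rearrange = solve 4 (λ x x′ y y′ → (x :- y) :- (x′ :- y′) := (x :- x′) :- (y :- y′)) refl

  -- A constant vector is a multiple of 1 + ζ + ⋯ + ζ^(n-1); its product with b is constant again.
  ⊗-≃ˡ : ∀ {a a′} b → a ≃ a′ → a ⊗ b ≃ a′ ⊗ b
  ⊗-≃ˡ {a} {a′} b (differ-by d e) = differ-by (d ℤ.* sumFin b) λ k → begin
    (a ⊗ b) k ℤ.- (a′ ⊗ b) k
      ≡⟨ cong₂ ℤ._-_ (⊗-sumʳ a b k) (⊗-sumʳ a′ b k) ⟩
    sumFin (λ j → a (k ⊖ j) ℤ.* b j) ℤ.- sumFin (λ j → a′ (k ⊖ j) ℤ.* b j)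
      ≡⟨ sumFin-− (λ j → a (k ⊖ j) ℤ.* b j) (λ j → a′ (k ⊖ j) ℤ.* b j) ⟩
    sumFin (λ j → a (k ⊖ j) ℤ.* b j ℤ.- a′ (k ⊖ j) ℤ.* b j)
      ≡⟨ sumFin-cong (λ j → trans (factor (a (k ⊖ j)) (a′ (k ⊖ j)) (b j)) (cong (ℤ._* b j) (e (k ⊖ j)))) ⟩
    sumFin (λ j → d ℤ.* b j)
      ≡⟨ sumFin-*ˡ d b ⟩
    d ℤ.* sumFin b ∎
    where
    open ≡-Reasoning
    factor : ∀ x y z → x ℤ.* z ℤ.- y ℤ.* z ≡ (x ℤ.- y) ℤ.* z
    factor = solve 3 (λ x y z → x :* z :- y :* z := (x :- y) :* z) refl

  ⊗-≃ : ∀ {a a′ b b′} → a ≃ a′ → b ≃ b′ → a ⊗ b ≃ a′ ⊗ b′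
  ⊗-≃ {a} {a′} {b} {b′} a≃a′ b≃b′ = begin
    a ⊗ b     ≈⟨ ⊗-≃ˡ b a≃a′ ⟩
    a′ ⊗ b    ≈⟨ ≗⇒≃ (⊗-comm a′ b) ⟩
    b ⊗ a′    ≈⟨ ⊗-≃ˡ a′ b≃b′ ⟩
    b′ ⊗ a′   ≈⟨ ≗⇒≃ (⊗-comm b′ a′) ⟩
    a′ ⊗ b′   ∎
    where open ≃-Reasoning

  ΣL-pointwise : {X : Set} (xs : List X) (f : X → Zζ n) (k : Fin n) → ΣL xs f k ≡ Σℤ xs (λ x → f x k)
  ΣL-pointwise []       f k = refl
  ΣL-pointwise (x ∷ xs) f k = cong (ℤ._+_ (f x k)) (ΣL-pointwise xs f k)

  ΣL-cong : {X : Set} (xs : List X) {f g : X → Zζ n} → (∀ x → f x ≗ g x) → ΣL xs f ≗ ΣL xs g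
  ΣL-cong []       e k = refl
  ΣL-cong (x ∷ xs) e k = cong₂ ℤ._+_ (e x k) (ΣL-cong xs e k)

  ΣL-≃ : {X : Set} (xs : List X) {f g : X → Zζ n} → (∀ x → f x ≃ g x) → ΣL xs f ≃ ΣL xs g
  ΣL-≃ []       e = ≃-refl
  ΣL-≃ (x ∷ xs) e = ⊕-≃ (e x) (ΣL-≃ xs e)

  ΣL-filter-≃ : {X : Set} {P : X → Set} (P? : ∀ x → Dec (P x)) (xs : List X) {f g : X → Zζ n} →
                (∀ x → P x → f x ≃ g x) → ΣL (filter P? xs) f ≃ ΣL (filter P? xs) g
  ΣL-filter-≃ P? []       e = ≃-refl
  ΣL-filter-≃ P? (x ∷ xs) e with P? x
  ... | yes px = ⊕-≃ (e x px) (ΣL-filter-≃ P? xs e)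
  ... | no _   = ΣL-filter-≃ P? xs e

  ΣL-⊗ʳ : {X : Set} (xs : List X) (f : X → Zζ n) (b : Zζ n) → ΣL xs f ⊗ b ≗ ΣL xs (λ x → f x ⊗ b)
  ΣL-⊗ʳ []       f b = ⊗-zeroˡ b
  ΣL-⊗ʳ (x ∷ xs) f b k =
    trans (⊗-distribʳ (f x) (ΣL xs f) b k) (cong (ℤ._+_ ((f x ⊗ b) k)) (ΣL-⊗ʳ xs f b k))

  ΣL-⊗ˡ : {X : Set} (xs : List X) (a : Zζ n) (f : X → Zζ n) → a ⊗ ΣL xs f ≗ ΣL xs (λ x → a ⊗ f x)
  ΣL-⊗ˡ xs a f k =
    trans (⊗-comm a (ΣL xs f) k) (trans (ΣL-⊗ʳ xs f a k) (ΣL-cong xs (λ x → ⊗-comm (f x) a) k))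

  ΣL-filter : {X : Set} {P : X → Set} (P? : ∀ x → Dec (P x)) (xs : List X) (f : X → Zζ n) →
              ΣL (filter P? xs) f ≗ ΣL xs (λ x → if does (P? x) then f x else zeroζ)
  ΣL-filter P? []       f k = refl
  ΣL-filter P? (x ∷ xs) f k with does (P? x)
  ... | true  = cong (ℤ._+_ (f x k)) (ΣL-filter P? xs f k)
  ... | false = trans (ΣL-filter P? xs f k) (sym (ℤP.+-identityˡ _))

  ΣL-++ : {X : Set} (xs ys : List X) (f : X → Zζ n) → ΣL (xs ++ ys) f ≗ ΣL xs f ⊕ ΣL ys f
  ΣL-++ []       ys f k = sym (ℤP.+-identityˡ _)
  ΣL-++ (x ∷ xs) ys f k = trans (cong (ℤ._+_ (f x k)) (ΣL-++ xs ys f k)) (sym (ℤP.+-assoc (f x k) _ _))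

  ΣL-map : {X Y : Set} (g : X → Y) (xs : List X) (f : Y → Zζ n) → ΣL (map g xs) f ≗ ΣL xs (f ∘ g)
  ΣL-map g []       f k = refl
  ΣL-map g (x ∷ xs) f k = cong (ℤ._+_ (f (g x) k)) (ΣL-map g xs f k)

  ΣL-concatMap : {X Y : Set} (g : X → List Y) (xs : List X) (f : Y → Zζ n) →
                 ΣL (concatMap g xs) f ≗ ΣL xs (λ x → ΣL (g x) f)
  ΣL-concatMap g []       f k = refl
  ΣL-concatMap g (x ∷ xs) f k =
    trans (ΣL-++ (g x) (concatMap g xs) f k) (cong (ℤ._+_ (ΣL (g x) f k)) (ΣL-concatMap g xs f k))

  ΣL-zero : {X : Set} (xs : List X) → ΣL xs (λ _ → zeroζ) ≗ zeroζ
  ΣL-zero []       k = refl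
  ΣL-zero (x ∷ xs) k = trans (ℤP.+-identityˡ _) (ΣL-zero xs k)

  ΣL-const : {X : Set} (xs : List X) (a : Zζ n) → ΣL xs (λ _ → a) ≗ (λ k → + length xs ℤ.* a k)
  ΣL-const xs a k = trans (ΣL-pointwise xs _ k) (Σℤ-const xs (a k))

  ΠFin-≃ : ∀ {k} {f g : Fin k → Zζ n} → (∀ i → f i ≃ g i) → ΠFin f ≃ ΠFin g
  ΠFin-≃ {zero}  e = ≃-refl
  ΠFin-≃ {suc k} e = ⊗-≃ (e Fin.zero) (ΠFin-≃ (e ∘ Fin.suc))

  rotation-invariant⇒constant : (S : Zζ n) → S ⊗ ζ^ 1 ≗ S → S ≃ zeroζ
  rotation-invariant⇒constant S invariant =
    differ-by (S 0F) (λ k → trans (ℤP.+-identityʳ (S k)) (constant (toℕ k) k refl))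
    where
    0F 1F : Fin n
    0F = fromℕ< 0<n
    1F = fromℕ< 2≤n
    shift : ∀ k → S (k ⊖ 1F) ≡ S k
    shift k = begin
      S (k ⊖ 1F)               ≡⟨ sym (ℤP.*-identityˡ _) ⟩
      + 1 ℤ.* S (k ⊖ 1F)       ≡⟨ sym (monomial-⊗ (+ 1) 2≤n S k) ⟩
      (ζ^ 1 ⊗ S) k             ≡⟨ ⊗-comm (ζ^ 1) S k ⟩
      (S ⊗ ζ^ 1) k             ≡⟨ invariant k ⟩
      S k                      ∎
      where open ≡-Reasoning
    constant : ∀ m k → toℕ k ≡ m → S k ≡ S 0F
    constant zero    k k≡0 = cong S (FinP.toℕ-injective (trans k≡0 (sym (FinP.toℕ-fromℕ< 0<n))))
    constant (suc m) k k≡1+m = trans (sym (shift k)) (constant m (k ⊖ 1F) k⊖1≡m)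
      where
      m<n : m < n
      m<n = ℕP.<-trans (ℕP.n<1+n m) (subst (_< n) k≡1+m (FinP.toℕ<n k))
      k⊖1≡m : toℕ (k ⊖ 1F) ≡ m
      k⊖1≡m = SumMod-injective (FinP.toℕ<n (k ⊖ 1F)) m<n
        (subst (λ i → SumMod i (toℕ (k ⊖ 1F)) (toℕ k)) (FinP.toℕ-fromℕ< 2≤n) (⊖-SumMod k 1F))
        (exact (sym k≡1+m))

  ΣL-if-⊗ˡ : {X : Set} (xs : List X) (b : X → Bool) (a : Zζ n) (g : X → Zζ n) →
             ΣL xs (λ x → if b x then a ⊗ g x else zeroζ) ≗ a ⊗ ΣL xs (λ x → if b x then g x else zeroζ)
  ΣL-if-⊗ˡ xs b a g k = trans (ΣL-cong xs if-⊗ k) (sym (ΣL-⊗ˡ xs a _ k))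
    where
    if-⊗ : ∀ x → (if b x then a ⊗ g x else zeroζ) ≗ a ⊗ (if b x then g x else zeroζ)
    if-⊗ x with b x
    ... | true  = λ _ → refl
    ... | false = λ k → sym (⊗-zeroʳ a k)

  if-≃ : ∀ (b : Bool) {x y} z → x ≃ y → (if b then x else z) ≃ (if b then y else z)
  if-≃ true  z x≃y = x≃y
  if-≃ false z x≃y = ≃-refl

module FieldProperties (F : FiniteField) where
  open FF F public hiding (_+_; _*_; -_; _⁻¹)
  open FiniteField F public using ()
    renaming (_+_ to infixl 6 _+_; _*_ to infixl 7 _*_; -_ to infix 8 -_; _⁻¹ to infix 9 _⁻¹)
  open IsCommutativeRing isCommutativeRing public
    using ( +-assoc; +-comm; +-identityˡ; +-identityʳ; *-assoc; *-comm; *-identityˡ; *-identityʳ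
          ; distribˡ; distribʳ; zeroˡ; zeroʳ; -‿inverseˡ; -‿inverseʳ)

  ring : CommutativeRing 0ℓ 0ℓ
  ring = record { isCommutativeRing = isCommutativeRing }

  open RingProperties (CommutativeRing.ring ring) public
    using (-0#≈0#; -‿involutive; -‿+-comm; +-inverseʳ-unique; -‿distribˡ-*; +-cancelʳ)
  open CommutativeSemigroupProperties (CommutativeRing.+-commutativeSemigroup ring) public
    using () renaming (interchange to +-interchange)

  infixl 6 _-_
  _-_ : Carrier → Carrier → Carrier
  a - b = a + - b

  ι-+ : ∀ m n → ι (m ℕ.+ n) ≡ ι m + ι n
  ι-+ zero    n = sym (+-identityˡ _)
  ι-+ (suc m) n = trans (cong (1# +_) (ι-+ m n)) (sym (+-assoc _ _ _))

  ι-* : ∀ m n → ι (m ℕ.* n) ≡ ι m * ι n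
  ι-* zero    n = sym (zeroˡ _)
  ι-* (suc m) n = begin
    ι (n ℕ.+ m ℕ.* n)       ≡⟨ ι-+ n (m ℕ.* n) ⟩
    ι n + ι (m ℕ.* n)       ≡⟨ cong₂ _+_ (sym (*-identityˡ (ι n))) (ι-* m n) ⟩
    1# * ι n + ι m * ι n    ≡⟨ sym (distribʳ _ _ _) ⟩
    (1# + ι m) * ι n        ∎
    where open ≡-Reasoning

  ι-^ : ∀ m k → ι (m ℕ.^ k) ≡ pow (ι m) k
  ι-^ m zero    = +-identityʳ 1#
  ι-^ m (suc k) = trans (ι-* m (m ℕ.^ k)) (cong (ι m *_) (ι-^ m k))

  ⟦_⟧ℤ : ℤ → Carrier
  ⟦ ℤ.+ n    ⟧ℤ = ι n
  ⟦ -[1+ n ] ⟧ℤ = - ι (suc n)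

  ⟦⊖⟧ℤ : ∀ m n → ⟦ m ℤ.⊖ n ⟧ℤ ≡ ι m - ι n
  ⟦⊖⟧ℤ m       zero    = sym (trans (cong (ι m +_) -0#≈0#) (+-identityʳ _))
  ⟦⊖⟧ℤ zero    (suc n) = sym (+-identityˡ _)
  ⟦⊖⟧ℤ (suc m) (suc n) = begin
    ⟦ suc m ℤ.⊖ suc n ⟧ℤ           ≡⟨ cong ⟦_⟧ℤ (ℤP.[1+m]⊖[1+n]≡m⊖n m n) ⟩
    ⟦ m ℤ.⊖ n ⟧ℤ                   ≡⟨ ⟦⊖⟧ℤ m n ⟩
    ι m - ι n                      ≡⟨ sym (+-identityˡ _) ⟩
    0# + (ι m - ι n)               ≡⟨ cong (_+ (ι m - ι n)) (sym (-‿inverseʳ 1#)) ⟩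
    (1# - 1#) + (ι m - ι n)        ≡⟨ +-interchange 1# (- 1#) (ι m) (- ι n) ⟩
    (1# + ι m) + (- 1# + - ι n)    ≡⟨ cong ((1# + ι m) +_) (-‿+-comm 1# (ι n)) ⟩
    (1# + ι m) - (1# + ι n)        ∎
    where open ≡-Reasoning

  sgn : Sign.Sign → Carrier
  sgn Sign.+ = 1#
  sgn Sign.- = - 1#

  ⟦◃⟧ℤ : ∀ s n → ⟦ s ℤ.◃ n ⟧ℤ ≡ sgn s * ι n
  ⟦◃⟧ℤ s      zero    = sym (zeroʳ _)
  ⟦◃⟧ℤ Sign.+ (suc n) = sym (*-identityˡ _)
  ⟦◃⟧ℤ Sign.- (suc n) = sym (trans (sym (-‿distribˡ-* 1# _)) (cong -_ (*-identityˡ _)))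

  ⟦⟧ℤ≡sgn*ι : ∀ z → ⟦ z ⟧ℤ ≡ sgn (ℤ.sign z) * ι ℤ.∣ z ∣
  ⟦⟧ℤ≡sgn*ι z = trans (cong ⟦_⟧ℤ (sym (ℤP.◃-inverse z))) (⟦◃⟧ℤ (ℤ.sign z) ℤ.∣ z ∣)

  sgn-* : ∀ s t → sgn (s Sign.* t) ≡ sgn s * sgn t
  sgn-* Sign.+ t      = sym (*-identityˡ _)
  sgn-* Sign.- Sign.+ = sym (*-identityʳ _)
  sgn-* Sign.- Sign.- = sym (trans (sym (-‿distribˡ-* 1# (- 1#))) (trans (cong -_ (*-identityˡ _)) (-‿involutive 1#)))

  ⟦*⟧ℤ : ∀ i j → ⟦ i ℤ.* j ⟧ℤ ≡ ⟦ i ⟧ℤ * ⟦ j ⟧ℤ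
  ⟦*⟧ℤ i j = begin
    ⟦ i ℤ.* j ⟧ℤ
      ≡⟨ ⟦◃⟧ℤ (ℤ.sign i Sign.* ℤ.sign j) (ℤ.∣ i ∣ ℕ.* ℤ.∣ j ∣) ⟩
    sgn (ℤ.sign i Sign.* ℤ.sign j) * ι (ℤ.∣ i ∣ ℕ.* ℤ.∣ j ∣)
      ≡⟨ cong₂ _*_ (sgn-* (ℤ.sign i) (ℤ.sign j)) (ι-* ℤ.∣ i ∣ ℤ.∣ j ∣) ⟩
    (sgn (ℤ.sign i) * sgn (ℤ.sign j)) * (ι ℤ.∣ i ∣ * ι ℤ.∣ j ∣)
      ≡⟨ *-interchange _ _ _ _ ⟩
    (sgn (ℤ.sign i) * ι ℤ.∣ i ∣) * (sgn (ℤ.sign j) * ι ℤ.∣ j ∣)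
      ≡⟨ sym (cong₂ _*_ (⟦⟧ℤ≡sgn*ι i) (⟦⟧ℤ≡sgn*ι j)) ⟩
    ⟦ i ⟧ℤ * ⟦ j ⟧ℤ ∎
    where
    open ≡-Reasoning
    open CommutativeSemigroupProperties (CommutativeRing.*-commutativeSemigroup ring)
      using () renaming (interchange to *-interchange)

  ⟦-⟧ℤ : ∀ i → ⟦ ℤ.- i ⟧ℤ ≡ - ⟦ i ⟧ℤ
  ⟦-⟧ℤ (ℤ.+ 0)    = sym -0#≈0#
  ⟦-⟧ℤ ℤ.+[1+ n ] = refl
  ⟦-⟧ℤ -[1+ n ]   = sym (-‿involutive _)

  ⟦+⟧ℤ : ∀ i j → ⟦ i ℤ.+ j ⟧ℤ ≡ ⟦ i ⟧ℤ + ⟦ j ⟧ℤ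
  ⟦+⟧ℤ (ℤ.+ m)    (ℤ.+ n)    = ι-+ m n
  ⟦+⟧ℤ (ℤ.+ m)    -[1+ n ]   = ⟦⊖⟧ℤ m (suc n)
  ⟦+⟧ℤ -[1+ m ]   (ℤ.+ n)    = trans (⟦⊖⟧ℤ n (suc m)) (+-comm _ _)
  ⟦+⟧ℤ -[1+ m ]   -[1+ n ]   = begin
    - ι (suc (suc (m ℕ.+ n)))      ≡⟨ cong (λ k → - ι (suc k)) (sym (ℕP.+-suc m n)) ⟩
    - ι (suc m ℕ.+ suc n)          ≡⟨ cong -_ (ι-+ (suc m) (suc n)) ⟩
    - (ι (suc m) + ι (suc n))      ≡⟨ sym (-‿+-comm _ _) ⟩
    - ι (suc m) + - ι (suc n)      ∎
    where open ≡-Reasoning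

  ℤ⟶F : ℤ.+-*-rawRing ACR.-Raw-AlmostCommutative⟶ ACR.fromCommutativeRing ring
  ℤ⟶F = record
    { ⟦_⟧ = ⟦_⟧ℤ ; +-homo = ⟦+⟧ℤ ; *-homo = ⟦*⟧ℤ ; -‿homo = ⟦-⟧ℤ ; 0-homo = refl ; 1-homo = +-identityʳ 1# }

  ⟦⟧ℤ-≟ : (a b : ℤ) → Maybe (⟦ a ⟧ℤ ≡ ⟦ b ⟧ℤ)
  ⟦⟧ℤ-≟ a b = Maybe.map (cong ⟦_⟧ℤ) (Decidable.dec⇒maybe (a ℤ.≟ b))

  -- A ring solver for F with integer coefficients: con (ℤ.+ k) denotes ι k (so con (ℤ.+ 1) is 1# + 0#, not 1#).
  module Solver = RingSolver ℤ.+-*-rawRing (ACR.fromCommutativeRing ring) ℤ⟶F ⟦⟧ℤ-≟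

  inverseˡ : ∀ a → ¬ a ≡ 0# → a ⁻¹ * a ≡ 1#
  inverseˡ a a≢0 = trans (*-comm _ _) (inverseʳ a a≢0)

  ⁻¹*-cancel : ∀ {a} → ¬ a ≡ 0# → ∀ x → a ⁻¹ * (a * x) ≡ x
  ⁻¹*-cancel {a} a≢0 x = trans (sym (*-assoc _ _ _)) (trans (cong (_* x) (inverseˡ a a≢0)) (*-identityˡ x))

  *⁻¹-cancel : ∀ {a} → ¬ a ≡ 0# → ∀ x → a * (a ⁻¹ * x) ≡ x
  *⁻¹-cancel {a} a≢0 x = trans (sym (*-assoc _ _ _)) (trans (cong (_* x) (inverseʳ a a≢0)) (*-identityˡ x))

  x*y≡0⇒x≡0⊎y≡0 : ∀ a b → a * b ≡ 0# → a ≡ 0# ⊎ b ≡ 0#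
  x*y≡0⇒x≡0⊎y≡0 a b ab≡0 with a ≟ 0#
  ... | yes a≡0 = inj₁ a≡0
  ... | no a≢0  = inj₂ (trans (sym (⁻¹*-cancel a≢0 b)) (trans (cong (a ⁻¹ *_) ab≡0) (zeroʳ _)))

  *-≢0 : ∀ {a b} → ¬ a ≡ 0# → ¬ b ≡ 0# → ¬ a * b ≡ 0#
  *-≢0 a≢0 b≢0 ab≡0 with x*y≡0⇒x≡0⊎y≡0 _ _ ab≡0
  ... | inj₁ a≡0 = a≢0 a≡0
  ... | inj₂ b≡0 = b≢0 b≡0

  ⁻¹-≢0 : ∀ {a} → ¬ a ≡ 0# → ¬ a ⁻¹ ≡ 0#
  ⁻¹-≢0 {a} a≢0 a⁻¹≡0 = 0≢1 (trans (sym (zeroʳ a)) (trans (cong (a *_) (sym a⁻¹≡0)) (inverseʳ a a≢0)))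

  *-cancelˡ : ∀ a b c → ¬ a ≡ 0# → a * b ≡ a * c → b ≡ c
  *-cancelˡ a b c a≢0 ab≡ac =
    trans (sym (⁻¹*-cancel a≢0 b)) (trans (cong (a ⁻¹ *_) ab≡ac) (⁻¹*-cancel a≢0 c))

  x-y≡0⇒x≡y : ∀ x y → x - y ≡ 0# → x ≡ y
  x-y≡0⇒x≡y x y x-y≡0 = trans (sym (-‿involutive x))
    (trans (cong -_ (sym (+-inverseʳ-unique x (- y) x-y≡0))) (-‿involutive y))

  pow≡0⇒≡0 : ∀ x k → pow x k ≡ 0# → x ≡ 0#
  pow≡0⇒≡0 x zero    1≡0 = ⊥-elim (0≢1 (sym 1≡0))
  pow≡0⇒≡0 x (suc k) xᵏ⁺¹≡0 with x*y≡0⇒x≡0⊎y≡0 x (pow x k) xᵏ⁺¹≡0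
  ... | inj₁ x≡0  = x≡0
  ... | inj₂ xᵏ≡0 = pow≡0⇒≡0 x k xᵏ≡0

  pow-+ : ∀ x m n → pow x (m ℕ.+ n) ≡ pow x m * pow x n
  pow-+ x zero    n = sym (*-identityˡ _)
  pow-+ x (suc m) n = trans (cong (x *_) (pow-+ x m n)) (sym (*-assoc _ _ _))

  pow-* : ∀ x m n → pow x (m ℕ.* n) ≡ pow (pow x m) n
  pow-* x m zero    rewrite ℕP.*-zeroʳ m  = refl
  pow-* x m (suc n) rewrite ℕP.*-suc m n = trans (pow-+ x m (m ℕ.* n)) (cong (pow x m *_) (pow-* x m n))

  pow-distrib-* : ∀ x y n → pow (x * y) n ≡ pow x n * pow y n
  pow-distrib-* x y zero    = sym (*-identityˡ _)
  pow-distrib-* x y (suc n) = trans (cong ((x * y) *_) (pow-distrib-* x y n)) (*-interchange _ _ _ _)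
    where
    open CommutativeSemigroupProperties (CommutativeRing.*-commutativeSemigroup ring)
      using () renaming (interchange to *-interchange)

  pow-1# : ∀ n → pow 1# n ≡ 1#
  pow-1# zero    = refl
  pow-1# (suc n) = trans (*-identityˡ _) (pow-1# n)

  pow-0# : ∀ n → 0 < n → pow 0# n ≡ 0#
  pow-0# (suc n) _ = zeroˡ _

  module ΣF = ListSum (IsCommutativeRing.+-isCommutativeMonoid isCommutativeRing)
  module ΣFᵉ = ΣF.Enumeration _≟_ elements complete unique
  module ΠF = ListSum (IsCommutativeRing.*-isCommutativeMonoid isCommutativeRing)
  module ΠFᵉ = ΠF.Enumeration _≟_ elements complete unique
  module ℤFᵉ = ℤSum.Enumeration _≟_ elements complete unique

  ΣF-1# : {X : Set} (xs : List X) → ΣF.Σ xs (λ _ → 1#) ≡ ι (length xs)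
  ΣF-1# []       = refl
  ΣF-1# (x ∷ xs) = cong (1# +_) (ΣF-1# xs)

  ΠF-const : {X : Set} (xs : List X) (c : Carrier) → ΠF.Σ xs (λ _ → c) ≡ pow c (length xs)
  ΠF-const []       c = refl
  ΠF-const (x ∷ xs) c = cong (c *_) (ΠF-const xs c)

  -- Translating by 1 permutes F, so adding q·1 to Σ x leaves it unchanged.
  ι-q≡0 : ι q ≡ 0#
  ι-q≡0 = +-cancelʳ S (ι q) 0# (begin
    ι q + S                  ≡⟨ +-comm _ _ ⟩
    S + ι q                  ≡⟨ cong (S +_) (trans (cong ι (sym size)) (sym (ΣF-1# elements))) ⟩
    S + ΣFᵉ.ΣX (λ _ → 1#)    ≡⟨ sym (ΣF.Σ-distrib elements (λ x → x) (λ _ → 1#)) ⟩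
    ΣFᵉ.ΣX (λ x → x + 1#)    ≡⟨ ΣFᵉ.ΣX-reindex (_+ 1#) (_- 1#) x+1-1≡x x-1+1≡x (λ x → x) ⟩
    S                        ≡⟨ sym (+-identityˡ S) ⟩
    0# + S                   ∎)
    where
    open ≡-Reasoning
    open Solver using (solve; _:+_; _:-_; _:=_)
    S : Carrier
    S = ΣFᵉ.ΣX (λ x → x)
    x+1-1≡x : ∀ x → (x + 1#) - 1# ≡ x
    x+1-1≡x x = solve 2 (λ x o → (x :+ o) :- o := x) refl x 1#
    x-1+1≡x : ∀ x → (x - 1#) + 1# ≡ x
    x-1+1≡x x = solve 2 (λ x o → (x :- o) :+ o := x) refl x 1#

  ι-p≡0 : ι p ≡ 0#
  ι-p≡0 = pow≡0⇒≡0 (ι p) r (trans (sym (ι-^ p r)) ι-q≡0)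

  ι-+p : ∀ a → ι (a ℕ.+ p) ≡ ι a
  ι-+p a = trans (ι-+ a p) (trans (cong (ι a +_) ι-p≡0) (+-identityʳ _))

  p≥2 : 2 ≤ p
  p≥2 = nonTrivial⇒n>1 p {{prime⇒nonTrivial p-prime}}

  p≥3 : 3 ≤ p
  p≥3 = ≥2∧≢2⇒≥3 p p≥2 p-odd
    where
    ≥2∧≢2⇒≥3 : ∀ n → 2 ≤ n → ¬ n ≡ 2 → 3 ≤ n
    ≥2∧≢2⇒≥3 (suc zero)          (s≤s ()) _
    ≥2∧≢2⇒≥3 (suc (suc zero))    _ n≢2 = ⊥-elim (n≢2 refl)
    ≥2∧≢2⇒≥3 (suc (suc (suc k))) _ _   = s≤s (s≤s (s≤s z≤n))

  p>0 : 0 < p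
  p>0 = ℕP.<-trans (s≤s z≤n) p≥2

  1+uv≢wz : ∀ u v w z → ι v ≡ 0# → ι z ≡ 0# → ¬ 1 ℕ.+ u ℕ.* v ≡ w ℕ.* z
  1+uv≢wz u v w z ιv≡0 ιz≡0 1+uv≡wz = 0≢1 (sym (begin
    1#                   ≡⟨ sym (+-identityʳ 1#) ⟩
    1# + 0#              ≡⟨ cong (1# +_) (sym (trans (cong (ι u *_) ιv≡0) (zeroʳ _))) ⟩
    1# + ι u * ι v       ≡⟨ cong (1# +_) (sym (ι-* u v)) ⟩
    ι (1 ℕ.+ u ℕ.* v)    ≡⟨ cong ι 1+uv≡wz ⟩
    ι (w ℕ.* z)          ≡⟨ ι-* w z ⟩
    ι w * ι z            ≡⟨ cong (ι w *_) ιz≡0 ⟩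
    ι w * 0#             ≡⟨ zeroʳ _ ⟩
    0#                   ∎))
    where open ≡-Reasoning

  -- A Bézout identity 1 + x t = y p (or 1 + y p = x t) would give 1 = 0 in F.
  ι-≢0 : ∀ t → 0 < t → t < p → ¬ ι t ≡ 0#
  ι-≢0 t 0<t t<p ιt≡0 with Bézout.identity (coprime⇒GCD≡1 t⊥p)
    where
    t⊥p : Coprime t p
    t⊥p {d} (d∣t , d∣p) with prime⇒irreducible p-prime d∣p
    ... | inj₁ d≡1  = d≡1
    ... | inj₂ refl = ⊥-elim (ℕP.<-irrefl refl (ℕP.<-≤-trans t<p (Div.∣⇒≤ {{ℕ.>-nonZero 0<t}} d∣t)))
  ... | Bézout.+- x y 1+yp≡xt = 1+uv≢wz y p x t ι-p≡0 ιt≡0 1+yp≡xt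
  ... | Bézout.-+ x y 1+xt≡yp = 1+uv≢wz x t y p ιt≡0 ι-p≡0 1+xt≡yp

  ι≢ι : ∀ {m n} → m < n → n < p → ¬ ι n ≡ ι m
  ι≢ι {m} {n} m<n n<p ιn≡ιm = ι-≢0 (n ℕ.∸ m) (ℕP.m<n⇒0<n∸m m<n) (ℕP.≤-<-trans (ℕP.m∸n≤m n m) n<p)
    (+-cancelʳ (ι m) (ι (n ℕ.∸ m)) 0#
      (trans (sym (ι-+ (n ℕ.∸ m) m)) (trans (cong ι (ℕP.m∸n+n≡m (ℕP.<⇒≤ m<n))) (trans ιn≡ιm (sym (+-identityˡ _))))))

  ι-injective : ∀ a b → a < p → b < p → ι a ≡ ι b → a ≡ b
  ι-injective a b a<p b<p ιa≡ιb with ℕP.<-cmp a b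
  ... | tri≈ _ a≡b _ = a≡b
  ... | tri< a<b _ _ = ⊥-elim (ι≢ι a<b b<p (sym ιa≡ιb))
  ... | tri> _ _ b<a = ⊥-elim (ι≢ι b<a a<p ιa≡ιb)

  ι2≢0 : ¬ ι 2 ≡ 0#
  ι2≢0 = ι-≢0 2 (s≤s z≤n) p≥3

  unitPart : Carrier → Carrier
  unitPart x = if does (x ≟ 0#) then 1# else x

  unitPart-≢0 : ∀ x → ¬ unitPart x ≡ 0#
  unitPart-≢0 x with x ≟ 0#
  ... | yes _   = λ 1≡0 → 0≢1 (sym 1≡0)
  ... | no x≢0  = x≢0

  Π-unitPart-≢0 : ∀ xs → ¬ ΠF.Σ xs unitPart ≡ 0#
  Π-unitPart-≢0 []       1≡0 = 0≢1 (sym 1≡0)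
  Π-unitPart-≢0 (x ∷ xs) = *-≢0 (unitPart-≢0 x) (Π-unitPart-≢0 xs)

  unitPart-* : ∀ {c} → ¬ c ≡ 0# → ∀ x → unitPart (c * x) ≡ ΠF.omit _≟_ 0# (λ _ → c) x * unitPart x
  unitPart-* {c} c≢0 x with x ≟ 0#
  ... | yes refl with (c * 0#) ≟ 0#
  ...   | yes _    = sym (*-identityˡ 1#)
  ...   | no c0≢0  = ⊥-elim (c0≢0 (zeroʳ c))
  unitPart-* {c} c≢0 x | no x≢0 with (c * x) ≟ 0#
  ...   | yes cx≡0 = ⊥-elim (*-≢0 c≢0 x≢0 cx≡0)
  ...   | no _     = refl

  -- c^(q-1) = 1: multiplying by c permutes the units, so it fixes their product.
  Π-units-const : ∀ {c} → ¬ c ≡ 0# → ΠFᵉ.ΣX (ΠF.omit _≟_ 0# (λ _ → c)) ≡ 1#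
  Π-units-const {c} c≢0 = *-cancelˡ P _ _ (Π-unitPart-≢0 elements) (begin
    P * ΠFᵉ.ΣX cᵘ                        ≡⟨ *-comm _ _ ⟩
    ΠFᵉ.ΣX cᵘ * P                        ≡⟨ sym (ΠF.Σ-distrib elements cᵘ unitPart) ⟩
    ΠFᵉ.ΣX (λ x → cᵘ x * unitPart x)     ≡⟨ sym (ΠF.Σ-cong elements (unitPart-* c≢0)) ⟩
    ΠFᵉ.ΣX (λ x → unitPart (c * x))      ≡⟨ ΠFᵉ.ΣX-reindex (c *_) (c ⁻¹ *_) (⁻¹*-cancel c≢0) (*⁻¹-cancel c≢0) unitPart ⟩
    P                                    ≡⟨ sym (*-identityʳ P) ⟩
    P * 1#                               ∎)
    where
    open ≡-Reasoning
    P : Carrier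
    P = ΠFᵉ.ΣX unitPart
    cᵘ : Carrier → Carrier
    cᵘ = ΠF.omit _≟_ 0# (λ _ → c)

  q>0 : 0 < q
  q>0 = ℕP.m^n>0 p {{ℕ.>-nonZero p>0}} r

  fermat : ∀ c → pow c q ≡ c
  fermat c with c ≟ 0#
  ... | yes refl = pow-0# q q>0
  ... | no c≢0   = begin
    pow c q                                   ≡⟨ cong (pow c) (sym size) ⟩
    pow c (length elements)                   ≡⟨ sym (ΠF-const elements c) ⟩
    ΠFᵉ.ΣX (λ _ → c)                          ≡⟨ ΠFᵉ.ΣX-extract 0# (λ _ → c) ⟩
    c * ΠFᵉ.ΣX (ΠF.omit _≟_ 0# (λ _ → c))     ≡⟨ cong (c *_) (Π-units-const c≢0) ⟩
    c * 1#                                    ≡⟨ *-identityʳ c ⟩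
    c                                         ∎
    where open ≡-Reasoning

module Frobenius (F : FiniteField) where
  open FieldProperties F
  module Binomial = BinomialProperties (CommutativeRing.commutativeSemiring ring)
  open import Algebra.Properties.Semiring.Exp (CommutativeRing.semiring ring) using () renaming (_^_ to _^ˢ_)
  open import Algebra.Properties.Semiring.Mult (CommutativeRing.semiring ring) using () renaming (_×_ to _×ˢ_)
  open import Algebra.Properties.Monoid.Sum (CommutativeRing.+-monoid ring) using (sum)

  ^ˢ≡pow : ∀ x n → x ^ˢ n ≡ pow x n
  ^ˢ≡pow x zero    = refl
  ^ˢ≡pow x (suc n) = cong (x *_) (^ˢ≡pow x n)

  ×ˢ≡ι* : ∀ m z → m ×ˢ z ≡ ι m * z
  ×ˢ≡ι* zero    z = sym (zeroˡ z)
  ×ˢ≡ι* (suc m) z = begin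
    z + m ×ˢ z          ≡⟨ cong₂ _+_ (sym (*-identityˡ z)) (×ˢ≡ι* m z) ⟩
    1# * z + ι m * z    ≡⟨ sym (distribʳ z 1# (ι m)) ⟩
    (1# + ι m) * z      ∎
    where open ≡-Reasoning

  p∤m! : ∀ m → m < p → ¬ p ∣ m ℕ.!
  p∤m! zero    _   p∣1 = ℕP.<-irrefl refl (ℕP.<-≤-trans (s≤s (s≤s z≤n)) (ℕP.≤-trans p≥2 (Div.∣⇒≤ p∣1)))
  p∤m! (suc m) m<p p∣m! with euclidsLemma (suc m) (m ℕ.!) p-prime p∣m!
  ... | inj₁ p∣1+m = ℕP.<-irrefl refl (ℕP.<-≤-trans m<p (Div.∣⇒≤ p∣1+m))
  ... | inj₂ p∣m!′ = p∤m! m (ℕP.<-trans (ℕP.n<1+n m) m<p) p∣m!′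

  p∣pCk : ∀ k → 0 < k → k < p → p ∣ p C k
  p∣pCk k 0<k k<p with euclidsLemma (p C k) (k ℕ.! ℕ.* (p ℕ.∸ k) ℕ.!) p-prime (subst (p ∣_) (sym pCk*k![p-k]!≡p!) p∣p!)
    where
    pCk*k![p-k]!≡p! : (p C k) ℕ.* (k ℕ.! ℕ.* (p ℕ.∸ k) ℕ.!) ≡ p ℕ.!
    pCk*k![p-k]!≡p! = trans (cong (ℕ._* (k ℕ.! ℕ.* (p ℕ.∸ k) ℕ.!)) (nCk≡n!/k![n-k]! (ℕP.<⇒≤ k<p)))
      (m/n*n≡m {{ℕP._!*_!≢0 k (p ℕ.∸ k)}} (k![n∸k]!∣n! (ℕP.<⇒≤ k<p)))
    p∣p! : p ∣ p ℕ.!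
    p∣p! with p | p≥2
    ... | suc p′ | _ = Div.m∣m*n (p′ ℕ.!)
  ... | inj₁ p∣pCk = p∣pCk
  ... | inj₂ p∣k![p-k]! with euclidsLemma (k ℕ.!) ((p ℕ.∸ k) ℕ.!) p-prime p∣k![p-k]!
  ...   | inj₁ p∣k!     = ⊥-elim (p∤m! k k<p p∣k!)
  ...   | inj₂ p∣[p-k]! = ⊥-elim (p∤m! (p ℕ.∸ k) (ℕP.∸-monoʳ-< 0<k (ℕP.<⇒≤ k<p)) p∣[p-k]!)

  sum-last : ∀ m (g : Fin (suc m) → Carrier) → (∀ k → toℕ k < m → g k ≡ 0#) → sum g ≡ g (Fin.fromℕ m)
  sum-last zero    g _       = +-identityʳ _
  sum-last (suc m) g g≡0 = trans (cong (_+ sum (g ∘ Fin.suc)) (g≡0 Fin.zero (s≤s z≤n)))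
    (trans (+-identityˡ _) (sum-last m (g ∘ Fin.suc) (λ k k<m → g≡0 (Fin.suc k) (s≤s k<m))))

  binomialTerm-first : ∀ x y m → Binomial.binomialTerm x y m Fin.zero ≡ pow y m
  binomialTerm-first x y m = trans (×ˢ≡ι* 1 _)
    (trans (cong₂ _*_ (+-identityʳ 1#) (trans (*-identityˡ _) (^ˢ≡pow y m))) (*-identityˡ _))

  binomialTerm-last : ∀ x y m → Binomial.binomialTerm x y m (Fin.fromℕ m) ≡ pow x m
  binomialTerm-last x y m = begin
    (m C toℕ (Fin.fromℕ m)) ×ˢ ((x ^ˢ toℕ (Fin.fromℕ m)) * (y ^ˢ (m ℕ.∸ toℕ (Fin.fromℕ m))))
      ≡⟨ cong (λ j → (m C j) ×ˢ ((x ^ˢ j) * (y ^ˢ (m ℕ.∸ j)))) (FinP.toℕ-fromℕ m) ⟩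
    (m C m) ×ˢ ((x ^ˢ m) * (y ^ˢ (m ℕ.∸ m)))
      ≡⟨ cong₂ (λ c d → c ×ˢ ((x ^ˢ m) * (y ^ˢ d))) (nCn≡1 m) (ℕP.n∸n≡0 m) ⟩
    1 ×ˢ ((x ^ˢ m) * 1#)
      ≡⟨ trans (×ˢ≡ι* 1 _) (trans (cong₂ _*_ (+-identityʳ 1#) (*-identityʳ _)) (*-identityˡ _)) ⟩
    x ^ˢ m
      ≡⟨ ^ˢ≡pow x m ⟩
    pow x m ∎
    where open ≡-Reasoning

  binomialTerm-middle : ∀ x y n → suc n ≡ p → ∀ k → toℕ k < n → Binomial.binomialTerm x y (suc n) (Fin.suc k) ≡ 0#
  binomialTerm-middle x y n 1+n≡p k k<n with p∣pCk (suc (toℕ k)) (s≤s z≤n) (subst (suc (toℕ k) <_) 1+n≡p (s≤s k<n))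
  ... | divides u pCk≡u*p = begin
    (suc n C suc (toℕ k)) ×ˢ b        ≡⟨ ×ˢ≡ι* (suc n C suc (toℕ k)) b ⟩
    ι (suc n C suc (toℕ k)) * b       ≡⟨ cong (λ c → ι c * b) (trans (cong (_C suc (toℕ k)) 1+n≡p) pCk≡u*p) ⟩
    ι (u ℕ.* p) * b                   ≡⟨ cong (_* b) (trans (ι-* u p) (trans (cong (ι u *_) ι-p≡0) (zeroʳ _))) ⟩
    0# * b                            ≡⟨ zeroˡ b ⟩
    0#                                ∎
    where
    open ≡-Reasoning
    b : Carrier
    b = Binomial.binomial x y (suc n) (Fin.suc k)

  frobenius : ∀ x y → pow (x + y) p ≡ pow x p + pow y p
  frobenius x y = begin
    pow (x + y) p                       ≡⟨ sym (^ˢ≡pow (x + y) p) ⟩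
    (x + y) ^ˢ p                        ≡⟨ Binomial.theorem p x y ⟩
    Binomial.binomialExpansion x y p    ≡⟨ expansion p refl ⟩
    pow x p + pow y p                   ∎
    where
    open ≡-Reasoning
    expansion : ∀ n → n ≡ p → Binomial.binomialExpansion x y n ≡ pow x n + pow y n
    expansion zero    0≡p = ⊥-elim (ℕP.<-irrefl refl (ℕP.<-≤-trans (s≤s z≤n) (subst (2 ≤_) (sym 0≡p) p≥2)))
    expansion (suc n) 1+n≡p = begin
      term Fin.zero + sum (term ∘ Fin.suc)
        ≡⟨ cong₂ _+_ (binomialTerm-first x y (suc n)) (sum-last n (term ∘ Fin.suc) (binomialTerm-middle x y n 1+n≡p)) ⟩
      pow y (suc n) + term (Fin.fromℕ (suc n))
        ≡⟨ cong (pow y (suc n) +_) (binomialTerm-last x y (suc n)) ⟩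
      pow y (suc n) + pow x (suc n)
        ≡⟨ +-comm _ _ ⟩
      pow x (suc n) + pow y (suc n) ∎
      where
      term : Fin (suc (suc n)) → Carrier
      term = Binomial.binomialTerm x y (suc n)

  frobenius-pᵏ : ∀ k x y → pow (x + y) (p ℕ.^ k) ≡ pow x (p ℕ.^ k) + pow y (p ℕ.^ k)
  frobenius-pᵏ zero    x y = trans (*-identityʳ _) (cong₂ _+_ (sym (*-identityʳ x)) (sym (*-identityʳ y)))
  frobenius-pᵏ (suc k) x y = begin
    pow (x + y) (p ℕ.* p ℕ.^ k)                         ≡⟨ pow-* (x + y) p (p ℕ.^ k) ⟩
    pow (pow (x + y) p) (p ℕ.^ k)                       ≡⟨ cong (λ z → pow z (p ℕ.^ k)) (frobenius x y) ⟩
    pow (pow x p + pow y p) (p ℕ.^ k)                   ≡⟨ frobenius-pᵏ k (pow x p) (pow y p) ⟩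
    pow (pow x p) (p ℕ.^ k) + pow (pow y p) (p ℕ.^ k)   ≡⟨ sym (cong₂ _+_ (pow-* x p (p ℕ.^ k)) (pow-* y p (p ℕ.^ k))) ⟩
    pow x (p ℕ.* p ℕ.^ k) + pow y (p ℕ.* p ℕ.^ k)       ∎
    where open ≡-Reasoning

-- Polynomials over F as coefficient lists, constant term first; g ++ [ c ] has degree length g.
module Polynomials (F : FiniteField) where
  open FieldProperties F
  open Solver using (solve; _:+_; _:*_; _:-_; _:=_; con)

  eval : List Carrier → Carrier → Carrier
  eval []       x = 0#
  eval (a ∷ as) x = a + x * eval as x

  -- The quotient of synthetic division by X - r.
  quotient : Carrier → List Carrier → List Carrier
  quotient r []       = []
  quotient r (b ∷ bs) = eval (b ∷ bs) r ∷ quotient r bs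

  eval-division : ∀ r a as x → eval (a ∷ as) x ≡ eval (a ∷ as) r + (x - r) * eval (quotient r as) x
  eval-division r a []       x = solve 3 (λ a x r → a :+ x :* con (ℤ.+ 0) := (a :+ r :* con (ℤ.+ 0)) :+ (x :- r) :* con (ℤ.+ 0)) refl a x r
  eval-division r a (b ∷ bs) x = trans (cong (λ z → a + x * z) (eval-division r b bs x))
    (solve 5 (λ a x r E Q → a :+ x :* (E :+ (x :- r) :* Q) := (a :+ r :* E) :+ (x :- r) :* (E :+ x :* Q)) refl
      a x r (eval (b ∷ bs) r) (eval (quotient r bs) x))

  quotient-shape : ∀ r g c → Σ[ g′ ∈ List Carrier ]
                   (quotient r (g ++ c ∷ []) ≡ g′ ++ (c + r * 0#) ∷ [] × length g′ ≡ length g)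
  quotient-shape r []      c = [] , refl , refl
  quotient-shape r (b ∷ g) c with quotient-shape r g c
  ... | g′ , q≡ , len≡ = eval (b ∷ g ++ c ∷ []) r ∷ g′ , cong (eval (b ∷ g ++ c ∷ []) r ∷_) q≡ , cong suc len≡

  roots≤degree : ∀ d g c → length g ≡ d → ¬ c ≡ 0# → (rs : List Carrier) → Unique rs →
                 All (λ x → eval (g ++ c ∷ []) x ≡ 0#) rs → length rs ≤ d
  roots≤degree d       g       c len c≢0 []        _ _ = z≤n
  roots≤degree d       []      c len c≢0 (x ∷ rs)  _ (root ∷ _) =
    ⊥-elim (c≢0 (trans (sym (trans (cong (c +_) (zeroʳ x)) (+-identityʳ c))) root))
  roots≤degree (suc d) (a ∷ g) c len c≢0 (r₀ ∷ rs) (r₀∉rs ∷ u) (root₀ ∷ roots)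
    with quotient-shape r₀ g c
  ... | g′ , q≡ , len′ = s≤s (roots≤degree d g′ (c + r₀ * 0#) (trans len′ (ℕP.suc-injective len))
          (λ c′≡0 → c≢0 (trans (sym (trans (cong (c +_) (zeroʳ r₀)) (+-identityʳ c))) c′≡0))
          rs u (quotient-roots rs r₀∉rs roots))
    where
    f : List Carrier
    f = a ∷ g ++ c ∷ []
    quotient-roots : ∀ ys → All (λ y → ¬ r₀ ≡ y) ys → All (λ x → eval f x ≡ 0#) ys →
                     All (λ x → eval (g′ ++ (c + r₀ * 0#) ∷ []) x ≡ 0#) ys
    quotient-roots []       _            _              = []
    quotient-roots (y ∷ ys) (r₀≢y ∷ ≢s) (rooty ∷ rootys) = quotient-root ∷ quotient-roots ys ≢s rootys
      where
      quotient-root : eval (g′ ++ (c + r₀ * 0#) ∷ []) y ≡ 0#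
      quotient-root with x*y≡0⇒x≡0⊎y≡0 (y - r₀) (eval (quotient r₀ (g ++ c ∷ [])) y)
        (trans (sym (+-identityˡ _)) (trans (cong (_+ ((y - r₀) * eval (quotient r₀ (g ++ c ∷ [])) y)) (sym root₀))
          (trans (sym (eval-division r₀ a (g ++ c ∷ []) y)) rooty)))
      ... | inj₁ y-r₀≡0 = ⊥-elim (r₀≢y (sym (x-y≡0⇒x≡y y r₀ y-r₀≡0)))
      ... | inj₂ Q[y]≡0 = trans (cong (λ w → eval w y) (sym q≡)) Q[y]≡0

  Xⁿ : ℕ → List Carrier
  Xⁿ n = replicate n 0# ++ 1# ∷ []

  eval-Xⁿ : ∀ n x → eval (Xⁿ n) x ≡ pow x n
  eval-Xⁿ zero    x = trans (cong (1# +_) (zeroʳ x)) (+-identityʳ 1#)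
  eval-Xⁿ (suc n) x = trans (+-identityˡ _) (cong (x *_) (eval-Xⁿ n x))

  infixl 6 _⊞_
  _⊞_ : List Carrier → List Carrier → List Carrier
  []       ⊞ g        = g
  (a ∷ as) ⊞ []       = a ∷ as
  (a ∷ as) ⊞ (b ∷ bs) = (a + b) ∷ (as ⊞ bs)

  eval-⊞ : ∀ f g x → eval (f ⊞ g) x ≡ eval f x + eval g x
  eval-⊞ []       g        x = sym (+-identityˡ _)
  eval-⊞ (a ∷ as) []       x = sym (+-identityʳ _)
  eval-⊞ (a ∷ as) (b ∷ bs) x = trans (cong (λ z → (a + b) + x * z) (eval-⊞ as bs x))
    (solve 5 (λ a b x A B → (a :+ b) :+ x :* (A :+ B) := (a :+ x :* A) :+ (b :+ x :* B)) refl a b x (eval as x) (eval bs x))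

  ⊞-shape : ∀ g c h → length h ≤ length g →
            Σ[ g′ ∈ List Carrier ] ((g ++ c ∷ []) ⊞ h ≡ g′ ++ c ∷ [] × length g′ ≡ length g)
  ⊞-shape []      c []      _         = [] , refl , refl
  ⊞-shape (a ∷ g) c []      _         = a ∷ g , refl , refl
  ⊞-shape (a ∷ g) c (b ∷ h) (s≤s h≤g) with ⊞-shape g c h h≤g
  ... | g′ , ⊞≡ , len≡ = (a + b) ∷ g′ , cong ((a + b) ∷_) ⊞≡ , cong suc len≡

module Trace (F : FiniteField) where
  open FieldProperties F
  open Frobenius F using (frobenius; frobenius-pᵏ)
  open Polynomials F
  open Cyclotomic p p≥2 using (SumMod; exact; overflow)

  partialTrace : Carrier → ℕ → Carrier
  partialTrace c zero    = 0#
  partialTrace c (suc k) = pow c (p ℕ.^ k) + partialTrace c k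

  -- Tr is a local recursion `go` of Defs, which cannot be named here; once r is
  -- abstracted, unification solves the meta go to it.
  Tr≡partialTrace : ∀ c → Tr c ≡ partialTrace c r
  Tr≡partialTrace c = trans unfold (go≗partialTrace r)
    where
    go : ℕ → Carrier
    go = _
    unfold : Tr c ≡ go r
    unfold with r
    ... | n = refl
    go≗partialTrace : ∀ n → go n ≡ partialTrace c n
    go≗partialTrace zero    = refl
    go≗partialTrace (suc n) = cong (pow c (p ℕ.^ n) +_) (go≗partialTrace n)

  partialTrace-+ : ∀ a b k → partialTrace (a + b) k ≡ partialTrace a k + partialTrace b k
  partialTrace-+ a b zero    = sym (+-identityˡ 0#)
  partialTrace-+ a b (suc k) =
    trans (cong₂ _+_ (frobenius-pᵏ k a b) (partialTrace-+ a b k)) (+-interchange _ _ _ _)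

  pow-pow-pᵏ : ∀ c k → pow (pow c (p ℕ.^ k)) p ≡ pow c (p ℕ.^ suc k)
  pow-pow-pᵏ c k = trans (sym (pow-* c (p ℕ.^ k) p)) (cong (pow c) (ℕP.*-comm (p ℕ.^ k) p))

  -- Frobenius shifts the terms c^(p^i) of the partial trace by one.
  partialTrace-frobenius : ∀ c k → pow (partialTrace c k) p + c ≡ partialTrace c k + pow c (p ℕ.^ k)
  partialTrace-frobenius c zero    =
    trans (cong (_+ c) (pow-0# p p>0)) (trans (+-identityˡ c) (trans (sym (*-identityʳ c)) (sym (+-identityˡ _))))
  partialTrace-frobenius c (suc k) = begin
    pow (cᵏ + t) p + c                ≡⟨ cong (_+ c) (frobenius cᵏ t) ⟩
    (pow cᵏ p + pow t p) + c          ≡⟨ +-assoc _ _ _ ⟩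
    pow cᵏ p + (pow t p + c)          ≡⟨ cong₂ _+_ (pow-pow-pᵏ c k) (partialTrace-frobenius c k) ⟩
    cᵏ⁺¹ + (t + cᵏ)                   ≡⟨ solve 3 (λ a b d → a :+ (b :+ d) := (d :+ b) :+ a) refl cᵏ⁺¹ t cᵏ ⟩
    (cᵏ + t) + cᵏ⁺¹                   ∎
    where
    open ≡-Reasoning
    open Solver using (solve; _:+_; _:=_)
    cᵏ cᵏ⁺¹ t : Carrier
    cᵏ = pow c (p ℕ.^ k)
    cᵏ⁺¹ = pow c (p ℕ.^ suc k)
    t = partialTrace c k

  Tr-frobenius : ∀ c → pow (Tr c) p ≡ Tr c
  Tr-frobenius c = +-cancelʳ c _ _ (begin
    pow (Tr c) p + c                    ≡⟨ cong (λ t → pow t p + c) (Tr≡partialTrace c) ⟩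
    pow (partialTrace c r) p + c        ≡⟨ partialTrace-frobenius c r ⟩
    partialTrace c r + pow c q          ≡⟨ cong₂ _+_ (sym (Tr≡partialTrace c)) (fermat c) ⟩
    Tr c + c                            ∎)
    where open ≡-Reasoning

  Tr-+ : ∀ a b → Tr (a + b) ≡ Tr a + Tr b
  Tr-+ a b = trans (Tr≡partialTrace (a + b))
    (trans (partialTrace-+ a b r) (sym (cong₂ _+_ (Tr≡partialTrace a) (Tr≡partialTrace b))))

  Tr-0# : Tr 0# ≡ 0#
  Tr-0# = trans (Tr≡partialTrace 0#) (partialTrace-0# r)
    where
    partialTrace-0# : ∀ k → partialTrace 0# k ≡ 0#
    partialTrace-0# zero    = refl
    partialTrace-0# (suc k) = trans (cong₂ _+_ (pow-0# (p ℕ.^ k) (ℕP.m^n>0 p {{ℕ.>-nonZero p>0}} k)) (partialTrace-0# k))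
                                    (+-identityˡ 0#)

  pow-ι-p : ∀ t → pow (ι t) p ≡ ι t
  pow-ι-p zero    = pow-0# p p>0
  pow-ι-p (suc t) = trans (frobenius 1# (ι t)) (cong₂ _+_ (pow-1# p) (pow-ι-p t))

  ι-below : ℕ → List Carrier
  ι-below zero    = []
  ι-below (suc n) = ι n ∷ ι-below n

  length-ι-below : ∀ n → length (ι-below n) ≡ n
  length-ι-below zero    = refl
  length-ι-below (suc n) = cong suc (length-ι-below n)

  ∉-ι-below : ∀ n y → (∀ t → t < n → ¬ ι t ≡ y) → All (λ z → ¬ y ≡ z) (ι-below n)
  ∉-ι-below zero    y ∉ = []
  ∉-ι-below (suc n) y ∉ = (λ y≡ιn → ∉ n (ℕP.n<1+n n) (sym y≡ιn)) ∷ ∉-ι-below n y (λ t t<n → ∉ t (ℕP.m<n⇒m<1+n t<n))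

  unique-ι-below : ∀ n → n ≤ p → Unique (ι-below n)
  unique-ι-below zero    _   = []
  unique-ι-below (suc n) n<p =
    ∉-ι-below n (ι n) (λ t t<n ιt≡ιn → ι≢ι t<n n<p (sym ιt≡ιn)) ∷ unique-ι-below n (ℕP.<⇒≤ n<p)

  Xᵖ-X : List Carrier
  Xᵖ-X with p | p≥2
  ... | suc zero     | s≤s ()
  ... | suc (suc p′) | _ = 0# ∷ - 1# ∷ replicate p′ 0#

  length-Xᵖ-X : length Xᵖ-X ≡ p
  length-Xᵖ-X with p | p≥2
  ... | suc zero     | s≤s ()
  ... | suc (suc p′) | _ = cong (λ n → suc (suc n)) (length-replicate p′)

  eval-Xᵖ-X : ∀ y → eval (Xᵖ-X ++ 1# ∷ []) y ≡ pow y p - y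
  eval-Xᵖ-X y with p | p≥2
  ... | suc zero     | s≤s ()
  ... | suc (suc p′) | _ = trans
    (solve 3 (λ y P o → con (ℤ.+ 0) :+ y :* (:- o :+ y :* P) := y :* (y :* P) :- y :* o) refl y (eval (Xⁿ p′) y) 1#)
    (cong₂ _-_ (cong (λ z → y * (y * z)) (eval-Xⁿ p′ y)) (*-identityʳ y))
    where open Solver using (solve; _:+_; _:*_; _:-_; :-_; _:=_; con)

  frobenius-fixed-root : ∀ y → pow y p ≡ y → eval (Xᵖ-X ++ 1# ∷ []) y ≡ 0#
  frobenius-fixed-root y yᵖ≡y = trans (eval-Xᵖ-X y) (trans (cong (_- y) yᵖ≡y) (-‿inverseʳ y))

  ι-below-roots : ∀ n → All (λ x → eval (Xᵖ-X ++ 1# ∷ []) x ≡ 0#) (ι-below n)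
  ι-below-roots zero    = []
  ι-below-roots (suc n) = frobenius-fixed-root (ι n) (pow-ι-p n) ∷ ι-below-roots n

  -- X^p - X already has the p roots ι 0, …, ι (p-1), so a further fixed point of Frobenius is impossible.
  frobenius-fixed⇒ι : ∀ y → pow y p ≡ y → Σ[ t ∈ ℕ ] t < p × ι t ≡ y
  frobenius-fixed⇒ι y yᵖ≡y with any? (λ t → ι t ≟ y) (upTo p)
  ... | yes found with find found
  ...   | t , t∈ , ιt≡y = t , ∈-upTo⁻ t∈ , ιt≡y
  frobenius-fixed⇒ι y yᵖ≡y | no none = ⊥-elim (ℕP.<-irrefl refl (subst (_≤ p) (cong suc (length-ι-below p)) too-many-roots))
    where
    ∉ : ∀ t → t < p → ¬ ι t ≡ y
    ∉ t t<p ιt≡y = none (lose (∈-upTo⁺ t<p) ιt≡y)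
    too-many-roots : length (y ∷ ι-below p) ≤ p
    too-many-roots = roots≤degree p Xᵖ-X 1# length-Xᵖ-X (λ 1≡0 → 0≢1 (sym 1≡0)) (y ∷ ι-below p)
      (∉-ι-below p y ∉ ∷ unique-ι-below p ℕP.≤-refl) (frobenius-fixed-root y yᵖ≡y ∷ ι-below-roots p)

  tracePoly : ℕ → List Carrier
  tracePoly zero    = []
  tracePoly (suc k) = Xⁿ (p ℕ.^ k) ⊞ tracePoly k

  eval-tracePoly : ∀ k x → eval (tracePoly k) x ≡ partialTrace x k
  eval-tracePoly zero    x = refl
  eval-tracePoly (suc k) x =
    trans (eval-⊞ (Xⁿ (p ℕ.^ k)) (tracePoly k) x) (cong₂ _+_ (eval-Xⁿ (p ℕ.^ k) x) (eval-tracePoly k x))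

  pᵏ>0 : ∀ k → 0 < p ℕ.^ k
  pᵏ>0 k = ℕP.m^n>0 p {{ℕ.>-nonZero p>0}} k

  pᵏ<pᵏ⁺¹ : ∀ k → p ℕ.^ k < p ℕ.^ suc k
  pᵏ<pᵏ⁺¹ k = ℕP.<-≤-trans (ℕP.m<m+n (p ℕ.^ k) (pᵏ>0 k))
    (subst (_≤ p ℕ.* p ℕ.^ k) (cong (p ℕ.^ k ℕ.+_) (ℕP.+-identityʳ (p ℕ.^ k))) (ℕP.*-monoˡ-≤ (p ℕ.^ k) p≥2))

  mutual
    tracePoly-monic : ∀ k → Σ[ g ∈ List Carrier ] (tracePoly (suc k) ≡ g ++ 1# ∷ [] × length g ≡ p ℕ.^ k)
    tracePoly-monic k with ⊞-shape (replicate (p ℕ.^ k) 0#) 1# (tracePoly k)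
                             (subst (length (tracePoly k) ≤_) (sym (length-replicate (p ℕ.^ k))) (length-tracePoly k))
    ... | g , shape , len = g , shape , trans len (length-replicate _)

    length-tracePoly : ∀ k → length (tracePoly k) ≤ p ℕ.^ k
    length-tracePoly zero    = z≤n
    length-tracePoly (suc k) with tracePoly-monic k
    ... | g , shape , len = subst (_≤ p ℕ.^ suc k) (sym length≡) (pᵏ<pᵏ⁺¹ k)
      where
      length≡ : length (tracePoly (suc k)) ≡ suc (p ℕ.^ k)
      length≡ = trans (cong length shape) (trans (length-++ g) (trans (ℕP.+-comm (length g) 1) (cong suc len)))

  -- Otherwise all q elements would be roots of the monic trace polynomial of degree p^(r-1) < q.
  Tr-≢0 : Σ[ a ∈ Carrier ] ¬ Tr a ≡ 0#
  Tr-≢0 with all? (λ x → Tr x ≟ 0#) elements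
  ... | no ¬all-zero = satisfied (¬All⇒Any¬ (λ x → Tr x ≟ 0#) elements ¬all-zero)
  ... | yes all-zero = ⊥-elim (too-many-roots r r≥1 refl)
    where
    too-many-roots : ∀ k → 1 ≤ k → k ≡ r → ⊥
    too-many-roots (suc k) _ 1+k≡r with tracePoly-monic k
    ... | g , shape , len = ℕP.<-irrefl refl (ℕP.<-≤-trans (subst (p ℕ.^ k <_) q≡length (pᵏ<pᵏ⁺¹ k)) roots≤)
      where
      q≡length : p ℕ.^ suc k ≡ length elements
      q≡length = trans (cong (p ℕ.^_) 1+k≡r) (sym size)
      roots : All (λ x → eval (g ++ 1# ∷ []) x ≡ 0#) elements
      roots = All.map (λ {x} Trx≡0 → begin
        eval (g ++ 1# ∷ []) x         ≡⟨ cong (λ f → eval f x) (sym shape) ⟩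
        eval (tracePoly (suc k)) x    ≡⟨ eval-tracePoly (suc k) x ⟩
        partialTrace x (suc k)        ≡⟨ cong (partialTrace x) 1+k≡r ⟩
        partialTrace x r              ≡⟨ sym (Tr≡partialTrace x) ⟩
        Tr x                          ≡⟨ Trx≡0 ⟩
        0#                            ∎) all-zero
        where open ≡-Reasoning
      roots≤ : length elements ≤ p ℕ.^ k
      roots≤ = roots≤degree (p ℕ.^ k) g 1# len (λ 1≡0 → 0≢1 (sym 1≡0)) elements unique roots

  ⁻¹-frobenius-fixed : ∀ t → ¬ t ≡ 0# → pow t p ≡ t → pow (t ⁻¹) p ≡ t ⁻¹
  ⁻¹-frobenius-fixed t t≢0 tᵖ≡t = *-cancelˡ t _ _ t≢0 (begin
    t * pow (t ⁻¹) p          ≡⟨ cong (_* pow (t ⁻¹) p) (sym tᵖ≡t) ⟩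
    pow t p * pow (t ⁻¹) p    ≡⟨ sym (pow-distrib-* t (t ⁻¹) p) ⟩
    pow (t * t ⁻¹) p          ≡⟨ cong (λ z → pow z p) (inverseʳ t t≢0) ⟩
    pow 1# p                  ≡⟨ pow-1# p ⟩
    1#                        ≡⟨ sym (inverseʳ t t≢0) ⟩
    t * t ⁻¹                  ∎)
    where open ≡-Reasoning

  frobenius-fixed-pᵏ : ∀ l → pow l p ≡ l → ∀ k → pow l (p ℕ.^ k) ≡ l
  frobenius-fixed-pᵏ l lᵖ≡l zero    = *-identityʳ l
  frobenius-fixed-pᵏ l lᵖ≡l (suc k) =
    trans (pow-* l p (p ℕ.^ k)) (trans (cong (λ z → pow z (p ℕ.^ k)) lᵖ≡l) (frobenius-fixed-pᵏ l lᵖ≡l k))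

  partialTrace-scale : ∀ l → pow l p ≡ l → ∀ a k → partialTrace (l * a) k ≡ l * partialTrace a k
  partialTrace-scale l lᵖ≡l a zero    = sym (zeroʳ l)
  partialTrace-scale l lᵖ≡l a (suc k) = trans
    (cong₂ _+_ (trans (pow-distrib-* l a (p ℕ.^ k)) (cong (_* pow a (p ℕ.^ k)) (frobenius-fixed-pᵏ l lᵖ≡l k)))
               (partialTrace-scale l lᵖ≡l a k))
    (sym (distribˡ l _ _))

  e₁ : Carrier
  e₁ = Tr (proj₁ Tr-≢0) ⁻¹ * proj₁ Tr-≢0

  Tr-e₁ : Tr e₁ ≡ 1#
  Tr-e₁ = begin
    Tr (t ⁻¹ * a)                   ≡⟨ Tr≡partialTrace (t ⁻¹ * a) ⟩
    partialTrace (t ⁻¹ * a) r       ≡⟨ partialTrace-scale (t ⁻¹) (⁻¹-frobenius-fixed t t≢0 (Tr-frobenius a)) a r ⟩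
    t ⁻¹ * partialTrace a r         ≡⟨ cong (t ⁻¹ *_) (sym (Tr≡partialTrace a)) ⟩
    t ⁻¹ * t                        ≡⟨ inverseˡ t t≢0 ⟩
    1#                              ∎
    where
    open ≡-Reasoning
    a t : Carrier
    a = proj₁ Tr-≢0
    t = Tr a
    t≢0 : ¬ t ≡ 0#
    t≢0 = proj₂ Tr-≢0

  firstTracePreimage : Carrier → List ℕ → ℕ
  firstTracePreimage c []       = 0
  firstTracePreimage c (t ∷ ts) with ι t ≟ Tr c
  ... | yes _ = t
  ... | no _  = firstTracePreimage c ts

  -- As for Tr, the local search of Defs' trℕ is recovered by unification.
  trℕ≡firstTracePreimage : ∀ c → trℕ c ≡ firstTracePreimage c (upTo p)
  trℕ≡firstTracePreimage c = trans unfold (search≗first (upTo p))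
    where
    search : List ℕ → ℕ
    search = _
    unfold : trℕ c ≡ search (upTo p)
    unfold with upTo p
    ... | ts = refl
    search≗first : ∀ ts → search ts ≡ firstTracePreimage c ts
    search≗first []       = refl
    search≗first (t ∷ ts) with ι t ≟ Tr c
    ... | yes _ = refl
    ... | no _  = search≗first ts

  firstTracePreimage-∈ : ∀ c ts → (Σ[ t ∈ ℕ ] t ∈ ts × ι t ≡ Tr c) →
                         firstTracePreimage c ts ∈ ts × ι (firstTracePreimage c ts) ≡ Tr c
  firstTracePreimage-∈ c (t ∷ ts) found with ι t ≟ Tr c
  ... | yes ιt≡Trc = here refl , ιt≡Trc
  ... | no ιt≢Trc with found
  ...   | _ , here refl , ιt≡Trc = ⊥-elim (ιt≢Trc ιt≡Trc)
  ...   | t′ , there t′∈ts , ιt′≡Trc with firstTracePreimage-∈ c ts (t′ , t′∈ts , ιt′≡Trc)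
  ...     | ∈ts , ι≡Trc = there ∈ts , ι≡Trc

  trℕ-spec : ∀ c → trℕ c < p × ι (trℕ c) ≡ Tr c
  trℕ-spec c with frobenius-fixed⇒ι (Tr c) (Tr-frobenius c)
  ... | t , t<p , ιt≡Trc with firstTracePreimage-∈ c (upTo p) (t , ∈-upTo⁺ t<p , ιt≡Trc)
  ...   | ∈upTo , ι≡Trc = subst (_< p) (sym (trℕ≡firstTracePreimage c)) (∈-upTo⁻ ∈upTo)
                        , trans (cong ι (trℕ≡firstTracePreimage c)) ι≡Trc

  trℕ<p : ∀ c → trℕ c < p
  trℕ<p c = proj₁ (trℕ-spec c)

  ι-trℕ : ∀ c → ι (trℕ c) ≡ Tr c
  ι-trℕ c = proj₂ (trℕ-spec c)

  trℕ-0# : trℕ 0# ≡ 0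
  trℕ-0# = ι-injective (trℕ 0#) 0 (trℕ<p 0#) p>0 (trans (ι-trℕ 0#) Tr-0#)

  trℕ-e₁ : trℕ e₁ ≡ 1
  trℕ-e₁ = ι-injective (trℕ e₁) 1 (trℕ<p e₁) p≥2 (trans (ι-trℕ e₁) (trans Tr-e₁ (sym (+-identityʳ 1#))))

  ι-trℕ-+ : ∀ a b → ι (trℕ a ℕ.+ trℕ b) ≡ ι (trℕ (a + b))
  ι-trℕ-+ a b = begin
    ι (trℕ a ℕ.+ trℕ b)         ≡⟨ ι-+ (trℕ a) (trℕ b) ⟩
    ι (trℕ a) + ι (trℕ b)       ≡⟨ cong₂ _+_ (ι-trℕ a) (ι-trℕ b) ⟩
    Tr a + Tr b                 ≡⟨ sym (Tr-+ a b) ⟩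
    Tr (a + b)                  ≡⟨ sym (ι-trℕ (a + b)) ⟩
    ι (trℕ (a + b))             ∎
    where open ≡-Reasoning

  trℕ-+ : ∀ a b → SumMod (trℕ a) (trℕ b) (trℕ (a + b))
  trℕ-+ a b with trℕ a ℕ.+ trℕ b ℕ.<? p
  ... | yes sum<p = exact (ι-injective _ _ sum<p (trℕ<p (a + b)) (ι-trℕ-+ a b))
  ... | no sum≮p  = overflow (trans (sym (ℕP.m∸n+n≡m p≤sum)) (cong (ℕ._+ p) s≡trℕ[a+b]))
    where
    p≤sum : p ≤ trℕ a ℕ.+ trℕ b
    p≤sum = ℕP.≮⇒≥ sum≮p
    s : ℕ
    s = trℕ a ℕ.+ trℕ b ℕ.∸ p
    s<p : s < p
    s<p = ℕP.+-cancelʳ-< p s p (subst (_< p ℕ.+ p) (sym (ℕP.m∸n+n≡m p≤sum)) (ℕP.+-mono-< (trℕ<p a) (trℕ<p b)))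
    s≡trℕ[a+b] : s ≡ trℕ (a + b)
    s≡trℕ[a+b] = ι-injective s (trℕ (a + b)) s<p (trℕ<p (a + b))
      (trans (sym (ι-+p s)) (trans (cong ι (ℕP.m∸n+n≡m p≤sum)) (ι-trℕ-+ a b)))

module AdditiveCharacter (F : FiniteField) where
  open FieldProperties F
  open Trace F
  open Cyclotomic p p≥2
  open Cyc p
  open Setup F using (χ₁)
  open import Data.Integer.Base using (+_)

  ΣL-reindex : (σ τ : Carrier → Carrier) → (∀ x → τ (σ x) ≡ x) → (∀ y → σ (τ y) ≡ y) →
               (f : Carrier → Zζ p) → ΣL elements (f ∘ σ) ≗ ΣL elements f
  ΣL-reindex σ τ τσ στ f k = trans (ΣL-pointwise elements (f ∘ σ) k)
    (trans (ℤFᵉ.ΣX-reindex σ τ τσ στ (λ x → f x k)) (sym (ΣL-pointwise elements f k)))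

  ΣL-translate : ∀ h (f : Carrier → Zζ p) → ΣL elements (λ x → f (x + h)) ≗ ΣL elements f
  ΣL-translate h = ΣL-reindex (_+ h) (_- h) (λ x → solve 2 (λ x h → (x :+ h) :- h := x) refl x h)
                                            (λ y → solve 2 (λ y h → (y :- h) :+ h := y) refl y h)
    where open Solver using (solve; _:+_; _:-_; _:=_)

  omit0 : (Carrier → Zζ p) → Carrier → Zζ p
  omit0 f x = if does (x ≟ 0#) then zeroζ else f x

  ΣL-extract0 : (f : Carrier → Zζ p) → ΣL elements f ≗ f 0# ⊕ ΣL elements (omit0 f)
  ΣL-extract0 f k = trans (ΣL-pointwise elements f k) (trans (ℤFᵉ.ΣX-extract 0# (λ x → f x k))
    (cong (ℤ._+_ (f 0# k)) (trans (ℤSum.Σ-cong elements omitted) (sym (ΣL-pointwise elements (omit0 f) k)))))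
    where
    omitted : ∀ x → ℤSum.omit _≟_ 0# (λ x → f x k) x ≡ omit0 f x k
    omitted x with does (x ≟ 0#)
    ... | true  = refl
    ... | false = refl

  χ₁-+ : ∀ a b → χ₁ (a + b) ≗ χ₁ a ⊗ χ₁ b
  χ₁-+ a b k = sym (ζ^-⊗-ζ^ (trℕ<p a) (trℕ<p b) (trℕ<p (a + b)) (trℕ-+ a b) k)

  χ₁-0# : χ₁ 0# ≗ oneζ
  χ₁-0# k = cong (λ t → ζ^ t k) trℕ-0#

  χ₁-e₁ : χ₁ e₁ ≗ ζ^ 1
  χ₁-e₁ k = cong (λ t → ζ^ t k) trℕ-e₁

  -- Translating c by a⁻¹ e₁ multiplies the sum by χ₁ e₁ = ζ, so the sum is rotation invariant.
  Σχ₁-≃0 : ∀ a → ¬ a ≡ 0# → ΣL elements (λ c → χ₁ (a * c)) ≃ zeroζ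
  Σχ₁-≃0 a a≢0 = rotation-invariant⇒constant S (begin
    S ⊗ ζ^ 1                                   ≈⟨ ⊗-congʳ S (λ k → sym (χ₁-e₁ k)) ⟩
    S ⊗ χ₁ e₁                                  ≈⟨ ΣL-⊗ʳ elements (λ c → χ₁ (a * c)) (χ₁ e₁) ⟩
    ΣL elements (λ c → χ₁ (a * c) ⊗ χ₁ e₁)     ≈⟨ ΣL-cong elements (λ c k → sym (χ₁-+ (a * c) e₁ k)) ⟩
    ΣL elements (λ c → χ₁ (a * c + e₁))        ≈⟨ ΣL-cong elements (λ c k → cong (λ z → χ₁ z k) (shifted c)) ⟩
    ΣL elements (λ c → χ₁ (a * (c + h)))       ≈⟨ ΣL-translate h (λ c → χ₁ (a * c)) ⟩
    S                                          ∎)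
    where
    open ≗-Reasoning
    S : Zζ p
    S = ΣL elements (λ c → χ₁ (a * c))
    h : Carrier
    h = a ⁻¹ * e₁
    shifted : ∀ c → a * c + e₁ ≡ a * (c + h)
    shifted c = trans (cong (_+_ (a * c)) (sym (*⁻¹-cancel a≢0 e₁))) (sym (distribˡ a c h))

  Σχ₁-0 : ΣL elements (λ c → χ₁ (0# * c)) ≗ ⟦ + q ⟧
  Σχ₁-0 = begin
    ΣL elements (λ c → χ₁ (0# * c))     ≈⟨ ΣL-cong elements (λ c k → trans (cong (λ z → χ₁ z k) (zeroˡ c)) (χ₁-0# k)) ⟩
    ΣL elements (λ _ → oneζ)            ≈⟨ ΣL-const elements oneζ ⟩
    (λ k → + length elements ℤ.* oneζ k) ≈⟨ q·1≗⟦q⟧ ⟩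
    ⟦ + q ⟧                              ∎
    where
    open ≗-Reasoning
    q·1≗⟦q⟧ : (λ k → + length elements ℤ.* oneζ k) ≗ ⟦ + q ⟧
    q·1≗⟦q⟧ k rewrite size with toℕ k ℕ.≟ 0
    ... | yes _ = ℤP.*-identityʳ (+ q)
    ... | no _  = ℤP.*-zeroʳ (+ q)

module QuadraticCharacter (F : FiniteField) where
  open FieldProperties F
  open Solver using (solve; _:+_; _:*_; _:-_; :-_; _:=_; con)
  open import Data.Integer.Base using () renaming (+_ to ⁺_)

  square-witness : ∀ c → isSquare c ≡ true → Σ[ y ∈ Carrier ] y * y ≡ c
  square-witness c isSq with satisfied (any⁻ (λ y → ⌊ (y * y) ≟ c ⌋) elements (subst T (sym isSq) _))
  ... | y , yy≟c = y , Decidable.toWitness yy≟c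

  isSquare-intro : ∀ c y → y * y ≡ c → isSquare c ≡ true
  isSquare-intro c y yy≡c =
    Equivalence.to BoolP.T-≡ (any⁺ (λ y → ⌊ (y * y) ≟ c ⌋) (lose (complete y) (Decidable.fromWitness yy≡c)))

  nonsquare-no-root : ∀ c → isSquare c ≡ false → ∀ y → ¬ y * y ≡ c
  nonsquare-no-root c nonSq y yy≡c with () ← trans (sym nonSq) (isSquare-intro c y yy≡c)

  η-cases : ∀ c → (isSquare c ≡ true × η c ≡ ⁺ 1) ⊎ (isSquare c ≡ false × η c ≡ -[1+ 0 ])
  η-cases c with isSquare c
  ... | true  = inj₁ (refl , refl)
  ... | false = inj₂ (refl , refl)

  η-square : ∀ c → isSquare c ≡ true → η c ≡ ⁺ 1
  η-square c isSq rewrite isSq = refl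

  η-nonsquare : ∀ c → isSquare c ≡ false → η c ≡ -[1+ 0 ]
  η-nonsquare c nonSq rewrite nonSq = refl

  square≢0 : ∀ {y} → ¬ y ≡ 0# → ¬ y * y ≡ 0#
  square≢0 y≢0 = *-≢0 y≢0 y≢0

  squares-equal : ∀ y z → y * y ≡ z * z → y ≡ z ⊎ y ≡ - z
  squares-equal y z yy≡zz
    with x*y≡0⇒x≡0⊎y≡0 (y - z) (y + z)
           (trans (solve 2 (λ y z → (y :- z) :* (y :+ z) := y :* y :- z :* z) refl y z)
                  (trans (cong (_- z * z) yy≡zz) (-‿inverseʳ (z * z))))
  ... | inj₁ y-z≡0 = inj₁ (x-y≡0⇒x≡y y z y-z≡0)
  ... | inj₂ y+z≡0 = inj₂ (trans (sym (-‿involutive y)) (cong -_ (sym (+-inverseʳ-unique y z y+z≡0))))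

  -- Uses that the characteristic is odd.
  ≢-self : ∀ y → ¬ y ≡ 0# → ¬ y ≡ - y
  ≢-self y y≢0 y≡-y = *-≢0 ι2≢0 y≢0 (begin
    ι 2 * y     ≡⟨ solve 1 (λ y → con (ℤ.+ 2) :* y := y :+ y) refl y ⟩
    y + y       ≡⟨ cong (y +_) y≡-y ⟩
    y + - y     ≡⟨ -‿inverseʳ y ⟩
    0#          ∎)
    where open ≡-Reasoning

  square*square : ∀ a b → isSquare a ≡ true → isSquare b ≡ true → isSquare (a * b) ≡ true
  square*square a b aSq bSq with square-witness a aSq | square-witness b bSq
  ... | y , yy≡a | z , zz≡b = isSquare-intro (a * b) (y * z)
    (trans (solve 2 (λ y z → (y :* z) :* (y :* z) := (y :* y) :* (z :* z)) refl y z) (cong₂ _*_ yy≡a zz≡b))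

  square*nonsquare : ∀ a b → ¬ a ≡ 0# → isSquare a ≡ true → isSquare b ≡ false → isSquare (a * b) ≡ false
  square*nonsquare a b a≢0 aSq bNonSq with isSquare (a * b) in abSq
  ... | false = refl
  ... | true with square-witness a aSq | square-witness (a * b) abSq
  ...   | y , yy≡a | w , ww≡ab = ⊥-elim (nonsquare-no-root b bNonSq (w * y ⁻¹) (begin
    (w * y ⁻¹) * (w * y ⁻¹)            ≡⟨ solve 2 (λ w v → (w :* v) :* (w :* v) := (w :* w) :* (v :* v)) refl w (y ⁻¹) ⟩
    (w * w) * (y ⁻¹ * y ⁻¹)            ≡⟨ cong (_* (y ⁻¹ * y ⁻¹)) (trans ww≡ab (cong (_* b) (sym yy≡a))) ⟩
    ((y * y) * b) * (y ⁻¹ * y ⁻¹)      ≡⟨ solve 3 (λ y b v → ((y :* y) :* b) :* (v :* v) := b :* ((y :* v) :* (y :* v))) refl y b (y ⁻¹) ⟩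
    b * ((y * y ⁻¹) * (y * y ⁻¹))      ≡⟨ cong (λ z → b * (z * z)) (inverseʳ y y≢0) ⟩
    b * (1# * 1#)                      ≡⟨ cong (b *_) (*-identityˡ 1#) ⟩
    b * 1#                             ≡⟨ *-identityʳ b ⟩
    b                                  ∎))
    where
    open ≡-Reasoning
    y≢0 : ¬ y ≡ 0#
    y≢0 y≡0 = a≢0 (trans (sym yy≡a) (trans (cong (λ z → z * z) y≡0) (zeroˡ 0#)))

  𝟙 : Bool → ℤ
  𝟙 b = if b then ⁺ 1 else ⁺ 0

  #√ : Carrier → ℤ
  #√ x = Σℤ elements (λ y → 𝟙 (does (x ≟ (y * y))))

  Σ-squares : (g : Carrier → ℤ) → Σℤ elements (λ y → g (y * y)) ≡ Σℤ elements (λ x → #√ x ℤ.* g x)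
  Σ-squares g = begin
    Σℤ elements (λ y → g (y * y))
      ≡⟨ ℤSum.Σ-cong elements (λ y → sym (ℤFᵉ.ΣX-indicator (y * y) g)) ⟩
    Σℤ elements (λ y → Σℤ elements (λ x → if does (x ≟ (y * y)) then g x else ⁺ 0))
      ≡⟨ ℤSum.Σ-comm elements elements _ ⟩
    Σℤ elements (λ x → Σℤ elements (λ y → if does (x ≟ (y * y)) then g x else ⁺ 0))
      ≡⟨ ℤSum.Σ-cong elements (λ x → trans (ℤSum.Σ-cong elements (λ y → if≡𝟙* (does (x ≟ (y * y))) (g x)))
                                            (Σℤ-*ʳ elements _ (g x))) ⟩
    Σℤ elements (λ x → #√ x ℤ.* g x) ∎
    where
    open ≡-Reasoning
    if≡𝟙* : ∀ b v → (if b then v else ⁺ 0) ≡ 𝟙 b ℤ.* v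
    if≡𝟙* true  v = sym (ℤP.*-identityˡ v)
    if≡𝟙* false v = refl

  #√0 : #√ 0# ≡ ⁺ 1
  #√0 = trans (ℤSum.Σ-cong elements root) (ℤFᵉ.ΣX-indicator 0# (λ _ → ⁺ 1))
    where
    root : ∀ y → 𝟙 (does (0# ≟ (y * y))) ≡ (if does (y ≟ 0#) then ⁺ 1 else ⁺ 0)
    root y with 0# ≟ (y * y) | y ≟ 0#
    ... | yes _     | yes _   = refl
    ... | no _      | no _    = refl
    ... | no 0≢00   | yes refl = ⊥-elim (0≢00 (sym (zeroˡ 0#)))
    ... | yes 0≡yy  | no y≢0  = ⊥-elim (square≢0 y≢0 (sym 0≡yy))

  -- A nonzero square has exactly the two square roots ±y₀, which differ since p is odd.
  #√≢0 : ∀ x → ¬ x ≡ 0# → #√ x ≡ ⁺ 1 ℤ.+ η x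
  #√≢0 x x≢0 with isSquare x in xSq
  ... | false = trans (ℤSum.Σ-cong elements no-root) (ℤSum.Σ-ε elements)
    where
    no-root : ∀ y → 𝟙 (does (x ≟ (y * y))) ≡ ⁺ 0
    no-root y with x ≟ (y * y)
    ... | yes x≡yy = ⊥-elim (nonsquare-no-root x xSq y (sym x≡yy))
    ... | no _     = refl
  ... | true with square-witness x xSq
  ...   | y₀ , y₀y₀≡x = trans (ℤSum.Σ-cong elements two-roots)
          (trans (ℤSum.Σ-distrib elements _ _)
                 (cong₂ ℤ._+_ (ℤFᵉ.ΣX-indicator y₀ (λ _ → ⁺ 1)) (ℤFᵉ.ΣX-indicator (- y₀) (λ _ → ⁺ 1))))
    where
    y₀≢0 : ¬ y₀ ≡ 0#
    y₀≢0 y₀≡0 = x≢0 (trans (sym y₀y₀≡x) (trans (cong (λ z → z * z) y₀≡0) (zeroˡ 0#)))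
    two-roots : ∀ y → 𝟙 (does (x ≟ (y * y))) ≡ (if does (y ≟ y₀) then ⁺ 1 else ⁺ 0) ℤ.+ (if does (y ≟ (- y₀)) then ⁺ 1 else ⁺ 0)
    two-roots y with x ≟ (y * y) | y ≟ y₀ | y ≟ (- y₀)
    ... | yes _    | yes refl | yes y≡-y = ⊥-elim (≢-self y y₀≢0 y≡-y)
    ... | yes _    | yes _    | no _     = refl
    ... | yes _    | no _     | yes _    = refl
    ... | yes x≡yy | no y≢y₀  | no y≢-y₀ with squares-equal y y₀ (trans (sym x≡yy) (sym y₀y₀≡x))
    ...   | inj₁ y≡y₀  = ⊥-elim (y≢y₀ y≡y₀)
    ...   | inj₂ y≡-y₀ = ⊥-elim (y≢-y₀ y≡-y₀)
    two-roots y | no x≢yy | yes refl | _       = ⊥-elim (x≢yy (sym y₀y₀≡x))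
    two-roots y | no x≢yy | no _    | yes refl =
      ⊥-elim (x≢yy (trans (sym y₀y₀≡x) (solve 1 (λ y → y :* y := (:- y) :* (:- y)) refl y₀)))
    two-roots y | no _    | no _    | no _    = refl

  Σ* : (Carrier → ℤ) → ℤ
  Σ* f = Σℤ elements (ℤSum.omit _≟_ 0# f)

  Σℤ≡f0+Σ* : ∀ f → Σℤ elements f ≡ f 0# ℤ.+ Σ* f
  Σℤ≡f0+Σ* f = ℤFᵉ.ΣX-extract 0# f

  Σ*-cong : ∀ {f g} → (∀ x → ¬ x ≡ 0# → f x ≡ g x) → Σ* f ≡ Σ* g
  Σ*-cong {f} {g} f≡g = ℤSum.Σ-cong elements pointwise
    where
    pointwise : ∀ x → ℤSum.omit _≟_ 0# f x ≡ ℤSum.omit _≟_ 0# g x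
    pointwise x with x ≟ 0#
    ... | yes _   = refl
    ... | no x≢0  = f≡g x x≢0

  Σ*-+ : ∀ f g → Σ* (λ x → f x ℤ.+ g x) ≡ Σ* f ℤ.+ Σ* g
  Σ*-+ f g = trans (ℤSum.Σ-cong elements pointwise) (ℤSum.Σ-distrib elements _ _)
    where
    pointwise : ∀ x → ℤSum.omit _≟_ 0# (λ x → f x ℤ.+ g x) x ≡ ℤSum.omit _≟_ 0# f x ℤ.+ ℤSum.omit _≟_ 0# g x
    pointwise x with x ≟ 0#
    ... | yes _ = refl
    ... | no _  = refl

  Σ*-*ˡ : ∀ c f → Σ* (λ x → c ℤ.* f x) ≡ c ℤ.* Σ* f
  Σ*-*ˡ c f = trans (ℤSum.Σ-cong elements pointwise) (Σℤ-*ˡ elements c _)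
    where
    pointwise : ∀ x → ℤSum.omit _≟_ 0# (λ x → c ℤ.* f x) x ≡ c ℤ.* ℤSum.omit _≟_ 0# f x
    pointwise x with x ≟ 0#
    ... | yes _ = sym (ℤP.*-zeroʳ c)
    ... | no _  = refl

  Σ*-scale : ∀ {a} → ¬ a ≡ 0# → ∀ f → Σ* (λ x → f (a * x)) ≡ Σ* f
  Σ*-scale {a} a≢0 f = trans (ℤSum.Σ-cong elements pointwise)
                             (ℤFᵉ.ΣX-reindex (a *_) (a ⁻¹ *_) (⁻¹*-cancel a≢0) (*⁻¹-cancel a≢0) (ℤSum.omit _≟_ 0# f))
    where
    pointwise : ∀ x → ℤSum.omit _≟_ 0# (λ x → f (a * x)) x ≡ ℤSum.omit _≟_ 0# f (a * x)
    pointwise x with x ≟ 0# | (a * x) ≟ 0#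
    ... | yes _    | yes _     = refl
    ... | no _     | no _      = refl
    ... | yes refl | no a0≢0   = ⊥-elim (a0≢0 (zeroʳ a))
    ... | no x≢0   | yes ax≡0  = ⊥-elim (*-≢0 a≢0 x≢0 ax≡0)

  Σ*-1 : ⁺ q ≡ ⁺ 1 ℤ.+ Σ* (λ _ → ⁺ 1)
  Σ*-1 = begin
    ⁺ q                              ≡⟨ cong ⁺_ (sym size) ⟩
    ⁺ length elements                ≡⟨ sym (trans (Σℤ-const elements (⁺ 1)) (ℤP.*-identityʳ _)) ⟩
    Σℤ elements (λ _ → ⁺ 1)          ≡⟨ Σℤ≡f0+Σ* (λ _ → ⁺ 1) ⟩
    ⁺ 1 ℤ.+ Σ* (λ _ → ⁺ 1)           ∎
    where open ≡-Reasoning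

  Σ#√ : Σℤ elements #√ ≡ ⁺ q
  Σ#√ = begin
    Σℤ elements #√                                                  ≡⟨ ℤSum.Σ-comm elements elements _ ⟩
    Σℤ elements (λ y → Σℤ elements (λ x → 𝟙 (does (x ≟ (y * y)))))     ≡⟨ ℤSum.Σ-cong elements (λ y → ℤFᵉ.ΣX-indicator (y * y) (λ _ → ⁺ 1)) ⟩
    Σℤ elements (λ _ → ⁺ 1)                                         ≡⟨ trans (Σℤ-const elements (⁺ 1)) (ℤP.*-identityʳ _) ⟩
    ⁺ length elements                                               ≡⟨ cong ⁺_ size ⟩
    ⁺ q                                                             ∎
    where open ≡-Reasoning

  -- Counting all square roots: q = 1 + Σ*(1 + η) = q + Σ* η.
  Σ*η≡0 : Σ* η ≡ ⁺ 0
  Σ*η≡0 = begin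
    Σ* η                                          ≡⟨ solve′ 3 (λ a b o → b :=′ (o :+′ (a :+′ b)) :-′ (o :+′ a)) refl (Σ* (λ _ → ⁺ 1)) (Σ* η) (⁺ 1) ⟩
    (⁺ 1 ℤ.+ (Σ* (λ _ → ⁺ 1) ℤ.+ Σ* η)) ℤ.- (⁺ 1 ℤ.+ Σ* (λ _ → ⁺ 1))
                                                  ≡⟨ cong₂ ℤ._-_ (sym q≡) (sym Σ*-1) ⟩
    ⁺ q ℤ.- ⁺ q                                   ≡⟨ ℤP.+-inverseʳ (⁺ q) ⟩
    ⁺ 0                                           ∎
    where
    open ≡-Reasoning
    open +-*-Solver using () renaming (solve to solve′; _:+_ to _:+′_; _:-_ to _:-′_; _:=_ to _:=′_)
    q≡ : ⁺ q ≡ ⁺ 1 ℤ.+ (Σ* (λ _ → ⁺ 1) ℤ.+ Σ* η)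
    q≡ = begin
      ⁺ q                                   ≡⟨ sym Σ#√ ⟩
      Σℤ elements #√                        ≡⟨ Σℤ≡f0+Σ* #√ ⟩
      #√ 0# ℤ.+ Σ* #√                       ≡⟨ cong₂ ℤ._+_ #√0 (Σ*-cong #√≢0) ⟩
      ⁺ 1 ℤ.+ Σ* (λ x → ⁺ 1 ℤ.+ η x)        ≡⟨ cong (ℤ._+_ (⁺ 1)) (Σ*-+ (λ _ → ⁺ 1) η) ⟩
      ⁺ 1 ℤ.+ (Σ* (λ _ → ⁺ 1) ℤ.+ Σ* η)     ∎

  -- For a nonsquare a every term of Σ* (η (a x) + η x) = 0 is ≤ 0, so each vanishes; at x = b this says η (a b) = 1.
  nonsquare*nonsquare : ∀ a b → ¬ a ≡ 0# → ¬ b ≡ 0# → isSquare a ≡ false → isSquare b ≡ false →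
                        isSquare (a * b) ≡ true
  nonsquare*nonsquare a b a≢0 b≢0 aNonSq bNonSq with isSquare (a * b) in abSq
  ... | true  = refl
  ... | false = ⊥-elim (-2≢0 (trans (sym Db≡-2) Db≡0))
    where
    -2≢0 : ¬ -[1+ 1 ] ≡ ⁺ 0
    -2≢0 ()
    D : Carrier → ℤ
    D x = η (a * x) ℤ.+ η x
    ΣD≡0 : Σ* D ≡ ⁺ 0
    ΣD≡0 = trans (Σ*-+ (λ x → η (a * x)) η) (cong₂ ℤ._+_ (trans (Σ*-scale a≢0 η) Σ*η≡0) Σ*η≡0)
    D≤0 : ∀ x → ℤSum.omit _≟_ 0# D x ℤ.≤ ⁺ 0
    D≤0 x with x ≟ 0#
    ... | yes _  = ℤP.≤-refl
    ... | no x≢0 with η-cases x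
    ...   | inj₁ (xSq , ηx≡1) = ℤP.≤-reflexive (cong₂ ℤ._+_
              (η-nonsquare (a * x) (trans (cong isSquare (*-comm a x)) (square*nonsquare x a x≢0 xSq aNonSq))) ηx≡1)
    ...   | inj₂ (_ , ηx≡-1) with η-cases (a * x)
    ...     | inj₁ (_ , ηax≡1)  = ℤP.≤-reflexive (cong₂ ℤ._+_ ηax≡1 ηx≡-1)
    ...     | inj₂ (_ , ηax≡-1) = subst (ℤ._≤ ⁺ 0) (sym (cong₂ ℤ._+_ ηax≡-1 ηx≡-1)) ℤ.-≤+
    Db≡-2 : D b ≡ -[1+ 1 ]
    Db≡-2 = cong₂ ℤ._+_ (η-nonsquare (a * b) abSq) (η-nonsquare b bNonSq)
    Db≡0 : D b ≡ ⁺ 0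
    Db≡0 = trans (sym (ℤSum.omit-≢ _≟_ D b≢0))
                 (Σℤ-nonpositive-zero elements (ℤSum.omit _≟_ 0# D) D≤0 ΣD≡0 (complete b))

  η-* : ∀ a b → ¬ a ≡ 0# → ¬ b ≡ 0# → η (a * b) ≡ η a ℤ.* η b
  η-* a b a≢0 b≢0 with η-cases a | η-cases b
  ... | inj₁ (aSq , ηa) | inj₁ (bSq , ηb) =
    trans (η-square (a * b) (square*square a b aSq bSq)) (sym (cong₂ ℤ._*_ ηa ηb))
  ... | inj₁ (aSq , ηa) | inj₂ (bNonSq , ηb) =
    trans (η-nonsquare (a * b) (square*nonsquare a b a≢0 aSq bNonSq)) (sym (cong₂ ℤ._*_ ηa ηb))
  ... | inj₂ (aNonSq , ηa) | inj₁ (bSq , ηb) =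
    trans (η-nonsquare (a * b) (trans (cong isSquare (*-comm a b)) (square*nonsquare b a b≢0 bSq aNonSq)))
          (sym (cong₂ ℤ._*_ ηa ηb))
  ... | inj₂ (aNonSq , ηa) | inj₂ (bNonSq , ηb) =
    trans (η-square (a * b) (nonsquare*nonsquare a b a≢0 b≢0 aNonSq bNonSq)) (sym (cong₂ ℤ._*_ ηa ηb))

  η*η : ∀ c → η c ℤ.* η c ≡ ⁺ 1
  η*η c with η-cases c
  ... | inj₁ (_ , ηc) rewrite ηc = refl
  ... | inj₂ (_ , ηc) rewrite ηc = refl

  η-⁻¹ : ∀ s → ¬ s ≡ 0# → η (s ⁻¹) ≡ η s
  η-⁻¹ s s≢0 = begin
    η (s ⁻¹)                          ≡⟨ sym (ℤP.*-identityˡ _) ⟩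
    ⁺ 1 ℤ.* η (s ⁻¹)                  ≡⟨ cong (ℤ._* η (s ⁻¹)) (sym (η*η s)) ⟩
    (η s ℤ.* η s) ℤ.* η (s ⁻¹)        ≡⟨ ℤP.*-assoc (η s) (η s) _ ⟩
    η s ℤ.* (η s ℤ.* η (s ⁻¹))        ≡⟨ cong (η s ℤ.*_) (sym (η-* s (s ⁻¹) s≢0 (⁻¹-≢0 s≢0))) ⟩
    η s ℤ.* η (s * s ⁻¹)              ≡⟨ cong (λ x → η s ℤ.* η x) (inverseʳ s s≢0) ⟩
    η s ℤ.* η 1#                      ≡⟨ cong (η s ℤ.*_) (η-square 1# (isSquare-intro 1# 1# (*-identityˡ 1#))) ⟩
    η s ℤ.* ⁺ 1                       ≡⟨ ℤP.*-identityʳ (η s) ⟩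
    η s                               ∎
    where open ≡-Reasoning

module GaussSum (F : FiniteField) where
  open FieldProperties F
  open QuadraticCharacter F
  open AdditiveCharacter F
  open Cyclotomic p p≥2
  open Cyc p
  open Setup F using (χ₁; G₁)
  open import Data.Integer.Base using () renaming (+_ to ⁺_)

  G₁-pointwise : ∀ k → G₁ k ≡ Σ* (λ c → η c ℤ.* χ₁ c k)
  G₁-pointwise k = trans (ΣL-pointwise elements _ k) (ℤSum.Σ-cong elements term)
    where
    term : ∀ c → (if ⌊ c ≟ 0# ⌋ then zeroζ else ⟦ η c ⟧ ⊗ χ₁ c) k ≡ ℤSum.omit _≟_ 0# (λ c → η c ℤ.* χ₁ c k) c
    term c with c ≟ 0#
    ... | yes _ = refl
    ... | no _  = ⟦⟧-⊗ (η c) (χ₁ c) k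

  -- Substituting x = s⁻¹ y, the quadratic character pulls out η (s⁻¹) = η s.
  Σ*-twisted : ∀ s → ¬ s ≡ 0# → ∀ k → Σ* (λ x → η x ℤ.* χ₁ (s * x) k) ≡ η s ℤ.* G₁ k
  Σ*-twisted s s≢0 k = begin
    Σ* (λ x → η x ℤ.* χ₁ (s * x) k)                          ≡⟨ sym (Σ*-scale (⁻¹-≢0 s≢0) _) ⟩
    Σ* (λ y → η (s ⁻¹ * y) ℤ.* χ₁ (s * (s ⁻¹ * y)) k)        ≡⟨ Σ*-cong substituted ⟩
    Σ* (λ y → η s ℤ.* (η y ℤ.* χ₁ y k))                      ≡⟨ Σ*-*ˡ (η s) _ ⟩
    η s ℤ.* Σ* (λ y → η y ℤ.* χ₁ y k)                        ≡⟨ cong (η s ℤ.*_) (sym (G₁-pointwise k)) ⟩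
    η s ℤ.* G₁ k                                             ∎
    where
    open ≡-Reasoning
    substituted : ∀ y → ¬ y ≡ 0# → η (s ⁻¹ * y) ℤ.* χ₁ (s * (s ⁻¹ * y)) k ≡ η s ℤ.* (η y ℤ.* χ₁ y k)
    substituted y y≢0 = begin
      η (s ⁻¹ * y) ℤ.* χ₁ (s * (s ⁻¹ * y)) k
        ≡⟨ cong₂ (λ e z → e ℤ.* χ₁ z k) (trans (η-* (s ⁻¹) y (⁻¹-≢0 s≢0) y≢0) (cong (ℤ._* η y) (η-⁻¹ s s≢0)))
                                       (*⁻¹-cancel s≢0 y) ⟩
      (η s ℤ.* η y) ℤ.* χ₁ y k
        ≡⟨ ℤP.*-assoc (η s) (η y) _ ⟩
      η s ℤ.* (η y ℤ.* χ₁ y k) ∎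

  -- Each x ≠ 0 is a square 1 + η x times.
  Σχ₁-square-pointwise : ∀ s → ¬ s ≡ 0# → ∀ k →
    ΣL elements (λ y → χ₁ (s * (y * y))) k ≡ ΣL elements (λ x → χ₁ (s * x)) k ℤ.+ η s ℤ.* G₁ k
  Σχ₁-square-pointwise s s≢0 k = begin
    ΣL elements (λ y → χ₁ (s * (y * y))) k
      ≡⟨ ΣL-pointwise elements _ k ⟩
    Σℤ elements (λ y → χ₁ (s * (y * y)) k)
      ≡⟨ Σ-squares (λ x → χ₁ (s * x) k) ⟩
    Σℤ elements (λ x → #√ x ℤ.* χ₁ (s * x) k)
      ≡⟨ Σℤ≡f0+Σ* _ ⟩
    #√ 0# ℤ.* χ₁ (s * 0#) k ℤ.+ Σ* (λ x → #√ x ℤ.* χ₁ (s * x) k)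
      ≡⟨ cong₂ ℤ._+_ (trans (cong (ℤ._* χ₁ (s * 0#) k) #√0) (ℤP.*-identityˡ _)) (Σ*-cong split) ⟩
    χ₁ (s * 0#) k ℤ.+ Σ* (λ x → χ₁ (s * x) k ℤ.+ η x ℤ.* χ₁ (s * x) k)
      ≡⟨ cong (ℤ._+_ (χ₁ (s * 0#) k)) (Σ*-+ _ _) ⟩
    χ₁ (s * 0#) k ℤ.+ (Σ* (λ x → χ₁ (s * x) k) ℤ.+ Σ* (λ x → η x ℤ.* χ₁ (s * x) k))
      ≡⟨ sym (ℤP.+-assoc (χ₁ (s * 0#) k) _ _) ⟩
    (χ₁ (s * 0#) k ℤ.+ Σ* (λ x → χ₁ (s * x) k)) ℤ.+ Σ* (λ x → η x ℤ.* χ₁ (s * x) k)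
      ≡⟨ cong₂ ℤ._+_ (trans (sym (Σℤ≡f0+Σ* _)) (sym (ΣL-pointwise elements _ k))) (Σ*-twisted s s≢0 k) ⟩
    ΣL elements (λ x → χ₁ (s * x)) k ℤ.+ η s ℤ.* G₁ k ∎
    where
    open ≡-Reasoning
    split : ∀ x → ¬ x ≡ 0# → #√ x ℤ.* χ₁ (s * x) k ≡ χ₁ (s * x) k ℤ.+ η x ℤ.* χ₁ (s * x) k
    split x x≢0 = trans (cong (ℤ._* χ₁ (s * x) k) (#√≢0 x x≢0))
      (trans (ℤP.*-distribʳ-+ (χ₁ (s * x) k) (⁺ 1) (η x)) (cong (ℤ._+ η x ℤ.* χ₁ (s * x) k) (ℤP.*-identityˡ (χ₁ (s * x) k))))

  gauss : ∀ s → ¬ s ≡ 0# → ΣL elements (λ y → χ₁ (s * (y * y))) ≃ ⟦ η s ⟧ ⊗ G₁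
  gauss s s≢0 = begin
    ΣL elements (λ y → χ₁ (s * (y * y)))              ≈⟨ ≗⇒≃ (Σχ₁-square-pointwise s s≢0) ⟩
    ΣL elements (λ x → χ₁ (s * x)) ⊕ ηs·G₁            ≈⟨ ⊕-≃ (Σχ₁-≃0 s s≢0) ≃-refl ⟩
    zeroζ ⊕ ηs·G₁                                     ≈⟨ ≗⇒≃ (λ k → trans (ℤP.+-identityˡ _) (sym (⟦⟧-⊗ (η s) G₁ k))) ⟩
    ⟦ η s ⟧ ⊗ G₁                                      ∎
    where
    open ≃-Reasoning
    ηs·G₁ : Zζ p
    ηs·G₁ k = η s ℤ.* G₁ k

module OneCoordinate (F : FiniteField) (s : FiniteField.Carrier F) where
  open FieldProperties F
  open AdditiveCharacter F
  open GaussSum F using (gauss)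
  open Cyclotomic p p≥2
  open Cyc p
  open Setup F using (χ₁; G₁; four)
  open import Data.Integer.Base using () renaming (+_ to ⁺_)

  term : Carrier → Carrier → Zζ p
  term m c = χ₁ (s * (c * c) + - (m * c))

  term-0# : ∀ m → term m 0# ≗ oneζ
  term-0# m k = trans (cong (λ z → χ₁ z k) (solve 2 (λ s m → s :* (o :* o) :+ :- (m :* o) := o) refl s m)) (χ₁-0# k)
    where
    open Solver using (solve; _:+_; _:*_; :-_; _:=_; con)
    o : Solver.Polynomial 2
    o = con (ℤ.+ 0)

  Σ*term : Carrier → Zζ p
  Σ*term m = ΣL elements (omit0 (term m))

  Σ*term≗Σterm⊝1 : ∀ m → Σ*term m ≗ ΣL elements (term m) ⊝ oneζ
  Σ*term≗Σterm⊝1 m k = begin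
    Σ*term m k                                  ≡⟨ solve 2 (λ a o → a := (o :+ a) :- o) refl (Σ*term m k) (oneζ k) ⟩
    (oneζ k ℤ.+ Σ*term m k) ℤ.- oneζ k          ≡⟨ cong (λ z → (z ℤ.+ Σ*term m k) ℤ.- oneζ k) (sym (term-0# m k)) ⟩
    (term m 0# k ℤ.+ Σ*term m k) ℤ.- oneζ k     ≡⟨ cong (ℤ._- oneζ k) (sym (ΣL-extract0 (term m) k)) ⟩
    ΣL elements (term m) k ℤ.- oneζ k           ∎
    where
    open ≡-Reasoning
    open +-*-Solver using (solve; _:+_; _:-_; _:=_)

  module NonzeroQuadratic (s≢0 : ¬ s ≡ 0#) where

    4s≢0 : ¬ four * s ≡ 0#
    4s≢0 = *-≢0 (λ 4≡0 → ι2≢0 (pow≡0⇒≡0 (ι 2) 2 (trans (sym 2²≡4) 4≡0))) s≢0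
      where
      2²≡4 : ι 4 ≡ pow (ι 2) 2
      2²≡4 = ι-^ 2 2

    u : Carrier
    u = (four * s) ⁻¹

    K : Carrier → Carrier
    K m = - ((m * m) * u)

    -- s (y + h)² - m (y + h) = s y² + K m + (4 s u - 1)(m y + m² u) with h = 2 m u, and 4 s u = 1.
    completed-square : ∀ m y → s * ((y + ι 2 * m * u) * (y + ι 2 * m * u)) + - (m * (y + ι 2 * m * u)) ≡ s * (y * y) + K m
    completed-square m y = begin
      s * ((y + h) * (y + h)) + - (m * (y + h))
        ≡⟨ solve 4 (λ s y m u →
             s :* ((y :+ con (ℤ.+ 2) :* m :* u) :* (y :+ con (ℤ.+ 2) :* m :* u)) :+ :- (m :* (y :+ con (ℤ.+ 2) :* m :* u))
             := (s :* (y :* y) :+ :- ((m :* m) :* u)) :+ (con (ℤ.+ 4) :* s :* u :- con (ℤ.+ 1)) :* (m :* y :+ (m :* m) :* u))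
             refl s y m u ⟩
      (s * (y * y) + K m) + (four * s * u - ι 1) * (m * y + (m * m) * u)
        ≡⟨ cong (λ z → (s * (y * y) + K m) + (z - ι 1) * (m * y + (m * m) * u)) (inverseʳ (four * s) 4s≢0) ⟩
      (s * (y * y) + K m) + (1# - ι 1) * (m * y + (m * m) * u)
        ≡⟨ cong (λ z → (s * (y * y) + K m) + (1# + - z) * (m * y + (m * m) * u)) (+-identityʳ 1#) ⟩
      (s * (y * y) + K m) + (1# - 1#) * (m * y + (m * m) * u)
        ≡⟨ cong (λ z → (s * (y * y) + K m) + z * (m * y + (m * m) * u)) (-‿inverseʳ 1#) ⟩
      (s * (y * y) + K m) + 0# * (m * y + (m * m) * u)
        ≡⟨ trans (cong ((s * (y * y) + K m) +_) (zeroˡ _)) (+-identityʳ _) ⟩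
      s * (y * y) + K m ∎
      where
      open ≡-Reasoning
      open Solver using (solve; _:+_; _:*_; _:-_; :-_; _:=_; con)
      h : Carrier
      h = ι 2 * m * u

    Σterm≗ : ∀ m → ΣL elements (term m) ≗ ΣL elements (λ y → χ₁ (s * (y * y))) ⊗ χ₁ (K m)
    Σterm≗ m = begin
      ΣL elements (term m)                                  ≈⟨ ≗-sym (ΣL-translate (ι 2 * m * u) (term m)) ⟩
      ΣL elements (λ y → term m (y + ι 2 * m * u))          ≈⟨ ΣL-cong elements (λ y k → cong (λ z → χ₁ z k) (completed-square m y)) ⟩
      ΣL elements (λ y → χ₁ (s * (y * y) + K m))            ≈⟨ ΣL-cong elements (λ y → χ₁-+ (s * (y * y)) (K m)) ⟩
      ΣL elements (λ y → χ₁ (s * (y * y)) ⊗ χ₁ (K m))       ≈⟨ ≗-sym (ΣL-⊗ʳ elements (λ y → χ₁ (s * (y * y))) (χ₁ (K m))) ⟩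
      ΣL elements (λ y → χ₁ (s * (y * y))) ⊗ χ₁ (K m)       ∎
      where
      open ≗-Reasoning
      ≗-sym : ∀ {a b : Zζ p} → a ≗ b → b ≗ a
      ≗-sym e k = sym (e k)

    Σ*term≃ : ∀ m → Σ*term m ≃ ((⟦ η s ⟧ ⊗ G₁) ⊗ χ₁ (K m)) ⊝ oneζ
    Σ*term≃ m = begin
      Σ*term m                                                        ≈⟨ ≗⇒≃ (Σ*term≗Σterm⊝1 m) ⟩
      ΣL elements (term m) ⊝ oneζ                                     ≈⟨ ⊝-≃ (≗⇒≃ (Σterm≗ m)) ≃-refl ⟩
      (ΣL elements (λ y → χ₁ (s * (y * y))) ⊗ χ₁ (K m)) ⊝ oneζ        ≈⟨ ⊝-≃ (⊗-≃ˡ (χ₁ (K m)) (gauss s s≢0)) ≃-refl ⟩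
      ((⟦ η s ⟧ ⊗ G₁) ⊗ χ₁ (K m)) ⊝ oneζ                              ∎
      where open ≃-Reasoning

  module ZeroQuadratic (s≡0 : s ≡ 0#) where

    zeroFactor : Carrier → ℤ
    zeroFactor m = if ⌊ m ≟ 0# ⌋ then ⁺ q ℤ.- ⁺ 1 else ℤ.- ⁺ 1

    Σterm≗Σlinear : ∀ m → ΣL elements (term m) ≗ ΣL elements (λ c → χ₁ ((- m) * c))
    Σterm≗Σlinear m = ΣL-cong elements (λ c k → cong (λ z → χ₁ z k)
      (trans (cong (λ z → z * (c * c) + - (m * c)) s≡0)
             (solve 2 (λ m c → con (ℤ.+ 0) :* (c :* c) :+ :- (m :* c) := (:- m) :* c) refl m c)))
      where open Solver using (solve; _:+_; _:*_; :-_; _:=_; con)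

    Σ*term≃ : ∀ m → Σ*term m ≃ ⟦ zeroFactor m ⟧
    Σ*term≃ m with m ≟ 0#
    ... | yes refl = ≗⇒≃ (λ k → begin
      Σ*term 0# k                                          ≡⟨ Σ*term≗Σterm⊝1 0# k ⟩
      ΣL elements (term 0#) k ℤ.- oneζ k                   ≡⟨ cong (ℤ._- oneζ k) (Σterm≗Σlinear 0# k) ⟩
      ΣL elements (λ c → χ₁ ((- 0#) * c)) k ℤ.- oneζ k     ≡⟨ cong (ℤ._- oneζ k) (ΣL-cong elements (λ c k → cong (λ z → χ₁ (z * c) k) -0#≈0#) k) ⟩
      ΣL elements (λ c → χ₁ (0# * c)) k ℤ.- oneζ k         ≡⟨ cong (ℤ._- oneζ k) (Σχ₁-0 k) ⟩
      ⟦ ⁺ q ⟧ k ℤ.- oneζ k                                 ≡⟨ ⟦⟧-⊝ (⁺ q) (⁺ 1) k ⟩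
      ⟦ ⁺ q ℤ.- ⁺ 1 ⟧ k                                    ∎)
      where open ≡-Reasoning
    ... | no m≢0 = begin
      Σ*term m                                        ≈⟨ ≗⇒≃ (Σ*term≗Σterm⊝1 m) ⟩
      ΣL elements (term m) ⊝ oneζ                     ≈⟨ ⊝-≃ (≗⇒≃ (Σterm≗Σlinear m)) ≃-refl ⟩
      ΣL elements (λ c → χ₁ ((- m) * c)) ⊝ oneζ       ≈⟨ ⊝-≃ (Σχ₁-≃0 (- m) -m≢0) ≃-refl ⟩
      zeroζ ⊝ oneζ                                    ≈⟨ ≗⇒≃ 0⊝1≗⟦-1⟧ ⟩
      ⟦ ℤ.- ⁺ 1 ⟧                                     ∎
      where
      open ≃-Reasoning
      -m≢0 : ¬ - m ≡ 0#
      -m≢0 -m≡0 = m≢0 (trans (sym (-‿involutive m)) (trans (cong -_ -m≡0) -0#≈0#))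
      0⊝1≗⟦-1⟧ : zeroζ ⊝ oneζ ≗ ⟦ ℤ.- ⁺ 1 ⟧
      0⊝1≗⟦-1⟧ k with toℕ k ℕ.≟ 0
      ... | yes _ = refl
      ... | no _  = refl

module ProductExpansion (F : FiniteField)
                        (f : FiniteField.Carrier F → FiniteField.Carrier F → Zζ (FiniteField.p F))
                        (f-0# : ∀ m → f m (FiniteField.0# F) ≗ Cyc.oneζ (FiniteField.p F)) where
  open FieldProperties F
  open AdditiveCharacter F using (omit0; ΣL-extract0)
  open Cyclotomic p p≥2
  open Cyc p
  open Setup F using (allVecs)

  Πf : ∀ {d} → Vec Carrier d → Vec Carrier d → Zζ p
  Πf []       []       = oneζ
  Πf (m ∷ ms) (x ∷ xs) = f m x ⊗ Πf ms xs

  Σ*f : Carrier → Zζ p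
  Σ*f m = ΣL elements (omit0 (f m))

  ΠΣ*f : ∀ {d} → Vec Carrier d → Subset d → Zζ p
  ΠΣ*f m I = ΠFin (λ i → if ⌊ lookup I i Bool.≟ true ⌋ then Σ*f (lookup m i) else oneζ)

  #nonzero : ∀ {d} → Vec Carrier d → ℕ
  #nonzero []       = 0
  #nonzero (x ∷ xs) = (if does (x ≟ 0#) then 0 else 1) ℕ.+ #nonzero xs

  ΣVec : ∀ {d} → Vec Carrier d → (ℕ → Bool) → Zζ p
  ΣVec {d} m c = ΣL (allVecs d) (λ x → if c (#nonzero x) then Πf m x else zeroζ)

  ΣSub : ∀ {d} → Vec Carrier d → (ℕ → Bool) → Zζ p
  ΣSub {d} m c = ΣL (allSubsets d) (λ I → if c ∣ I ∣ then ΠΣ*f m I else zeroζ)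

  ΣVec-∷ : ∀ {d} m₀ (ms : Vec Carrier d) c → ΣVec (m₀ ∷ ms) c ≗ ΣVec ms c ⊕ (Σ*f m₀ ⊗ ΣVec ms (c ∘ suc))
  ΣVec-∷ {d} m₀ ms c = begin
    ΣVec (m₀ ∷ ms) c                                        ≈⟨ ΣL-concatMap (λ x → map (x ∷_) (allVecs d)) elements term ⟩
    ΣL elements (λ x₀ → ΣL (map (x₀ ∷_) (allVecs d)) term)  ≈⟨ ΣL-cong elements (λ x₀ → ΣL-map (x₀ ∷_) (allVecs d) term) ⟩
    ΣL elements G                                           ≈⟨ ΣL-extract0 G ⟩
    G 0# ⊕ ΣL elements (omit0 G)                            ≈⟨ (λ k → cong₂ ℤ._+_ (G-0# k) (ΣL-cong elements G-≢0 k)) ⟩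
    ΣVec ms c ⊕ ΣL elements (λ x₀ → omit0 (f m₀) x₀ ⊗ ΣVec ms (c ∘ suc))
                                                            ≈⟨ (λ k → cong (ℤ._+_ (ΣVec ms c k)) (sym (ΣL-⊗ʳ elements _ _ k))) ⟩
    ΣVec ms c ⊕ (Σ*f m₀ ⊗ ΣVec ms (c ∘ suc))                  ∎
    where
    open ≗-Reasoning
    term : Vec Carrier (suc d) → Zζ p
    term x = if c (#nonzero x) then Πf (m₀ ∷ ms) x else zeroζ
    G : Carrier → Zζ p
    G x₀ = ΣL (allVecs d) (λ xs → term (x₀ ∷ xs))
    G-0# : G 0# ≗ ΣVec ms c
    G-0# with 0# ≟ 0#
    ... | no 0≢0 = ⊥-elim (0≢0 refl)
    ... | yes _  = λ k → trans (ΣL-if-⊗ˡ (allVecs d) (c ∘ #nonzero) (f m₀ 0#) (Πf ms) k)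
                              (trans (⊗-congˡ _ (f-0# m₀) k) (⊗-identityˡ _ k))
    G-≢0 : ∀ x₀ → omit0 G x₀ ≗ omit0 (f m₀) x₀ ⊗ ΣVec ms (c ∘ suc)
    G-≢0 x₀ with x₀ ≟ 0#
    ... | yes _ = λ k → sym (⊗-zeroˡ (ΣVec ms (c ∘ suc)) k)
    ... | no _  = ΣL-if-⊗ˡ (allVecs d) (c ∘ suc ∘ #nonzero) (f m₀ x₀) (Πf ms)

  ΣSub-∷ : ∀ {d} m₀ (ms : Vec Carrier d) c → ΣSub (m₀ ∷ ms) c ≗ (Σ*f m₀ ⊗ ΣSub ms (c ∘ suc)) ⊕ ΣSub ms c
  ΣSub-∷ {d} m₀ ms c = begin
    ΣSub (m₀ ∷ ms) c
      ≈⟨ ΣL-++ (map (inside ∷_) (allSubsets d)) (map (outside ∷_) (allSubsets d)) term ⟩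
    ΣL (map (inside ∷_) (allSubsets d)) term ⊕ ΣL (map (outside ∷_) (allSubsets d)) term
      ≈⟨ (λ k → cong₂ ℤ._+_ (ΣL-map (inside ∷_) (allSubsets d) term k) (ΣL-map (outside ∷_) (allSubsets d) term k)) ⟩
    ΣL (allSubsets d) (term ∘ (inside ∷_)) ⊕ ΣL (allSubsets d) (term ∘ (outside ∷_))
      ≈⟨ (λ k → cong₂ ℤ._+_ (ΣL-if-⊗ˡ (allSubsets d) (c ∘ suc ∘ ∣_∣) (Σ*f m₀) (ΠΣ*f ms) k)
                            (ΣL-cong (allSubsets d) outside-term k)) ⟩
    (Σ*f m₀ ⊗ ΣSub ms (c ∘ suc)) ⊕ ΣSub ms c
      ∎
    where
    open ≗-Reasoning
    term : Subset (suc d) → Zζ p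
    term I = if c ∣ I ∣ then ΠΣ*f (m₀ ∷ ms) I else zeroζ
    outside-term : ∀ I → term (outside ∷ I) ≗ (if c ∣ I ∣ then ΠΣ*f ms I else zeroζ)
    outside-term I with c ∣ I ∣
    ... | true  = ⊗-identityˡ (ΠΣ*f ms I)
    ... | false = λ _ → refl

  -- Inductively, the coordinate x₀ = 0 contributes the factor 1 and the coordinates x₀ ≠ 0 the factor Σ*f m₀.
  expansion : ∀ {d} (m : Vec Carrier d) c → ΣVec m c ≗ ΣSub m c
  expansion []       c k = refl
  expansion (m₀ ∷ ms) c = begin
    ΣVec (m₀ ∷ ms) c                                      ≈⟨ ΣVec-∷ m₀ ms c ⟩
    ΣVec ms c ⊕ (Σ*f m₀ ⊗ ΣVec ms (c ∘ suc))                ≈⟨ (λ k → cong₂ ℤ._+_ (expansion ms c k)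
                                                                (⊗-congʳ (Σ*f m₀) (expansion ms (c ∘ suc)) k)) ⟩
    ΣSub ms c ⊕ (Σ*f m₀ ⊗ ΣSub ms (c ∘ suc))                ≈⟨ (λ k → ℤP.+-comm (ΣSub ms c k) _) ⟩
    (Σ*f m₀ ⊗ ΣSub ms (c ∘ suc)) ⊕ ΣSub ms c                ≈⟨ (λ k → sym (ΣSub-∷ m₀ ms c k)) ⟩
    ΣSub (m₀ ∷ ms) c                                      ∎
    where open ≗-Reasoning

module CharacterSumOverNα (F : FiniteField) (s : FiniteField.Carrier F) where
  open FieldProperties F
  open AdditiveCharacter F using (χ₁-+; χ₁-0#)
  open OneCoordinate F s
  open ProductExpansion F term term-0#
  open Cyclotomic p p≥2
  open Cyc p
  open Setup F using (χ₁; ‖_‖; _·_; 𝒵; 𝒵ᵢ; N; allVecs; subsetsOfSize; LHS; RHS≠0; RHS0)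
  open import Data.Integer.Base using () renaming (+_ to ⁺_)

  χ₁-factorises : ∀ {d} (m x : Vec Carrier d) → χ₁ (s * ‖ x ‖ + - (m · x)) ≗ Πf m x
  χ₁-factorises []         []         k =
    trans (cong (λ z → χ₁ z k) (solve 1 (λ s → s :* con (ℤ.+ 0) :+ :- con (ℤ.+ 0) := con (ℤ.+ 0)) refl s)) (χ₁-0# k)
    where open Solver using (solve; _:+_; _:*_; :-_; _:=_; con)
  χ₁-factorises (m₀ ∷ ms) (x₀ ∷ xs) k = begin
    χ₁ (s * ‖ x₀ ∷ xs ‖ + - ((m₀ ∷ ms) · (x₀ ∷ xs))) k        ≡⟨ cong (λ z → χ₁ z k) split ⟩
    χ₁ (s * (x₀ * x₀) + - (m₀ * x₀) + (s * ‖ xs ‖ + - (ms · xs))) k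
                                                            ≡⟨ χ₁-+ (s * (x₀ * x₀) + - (m₀ * x₀)) (s * ‖ xs ‖ + - (ms · xs)) k ⟩
    (term m₀ x₀ ⊗ χ₁ (s * ‖ xs ‖ + - (ms · xs))) k          ≡⟨ ⊗-congʳ (term m₀ x₀) (χ₁-factorises ms xs) k ⟩
    (term m₀ x₀ ⊗ Πf ms xs) k                                ∎
    where
    open ≡-Reasoning
    open Solver using (solve; _:+_; _:*_; :-_; _:=_)
    split : s * (x₀ * x₀ + ‖ xs ‖) + - (m₀ * x₀ + ms · xs) ≡ s * (x₀ * x₀) + - (m₀ * x₀) + (s * ‖ xs ‖ + - (ms · xs))
    split = solve 5 (λ s x m a b → s :* (x :* x :+ a) :+ :- (m :* x :+ b) := (s :* (x :* x) :+ :- (m :* x)) :+ (s :* a :+ :- b))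
                  refl s x₀ m₀ ‖ xs ‖ (ms · xs)

  𝒵+#nonzero : ∀ {d} (x : Vec Carrier d) → 𝒵 x ℕ.+ #nonzero x ≡ d
  𝒵+#nonzero []       = refl
  𝒵+#nonzero (x ∷ xs) with x ≟ 0#
  ... | yes _ = cong suc (𝒵+#nonzero xs)
  ... | no _  = trans (ℕP.+-suc _ _) (cong suc (𝒵+#nonzero xs))

  𝒵≡α⇔#nonzero≡d-α : ∀ {d} α → α ≤ d → (x : Vec Carrier d) → (𝒵 x ≡ α) ⇔ (#nonzero x ≡ d ℕ.∸ α)
  𝒵≡α⇔#nonzero≡d-α {d} α α≤d x = mk⇔ (λ 𝒵≡α → begin
      #nonzero x                          ≡⟨ sym (ℕP.m+n∸m≡n (𝒵 x) (#nonzero x)) ⟩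
      (𝒵 x ℕ.+ #nonzero x) ℕ.∸ 𝒵 x        ≡⟨ cong₂ ℕ._∸_ (𝒵+#nonzero x) 𝒵≡α ⟩
      d ℕ.∸ α                             ∎)
    (λ #nonzero≡ → begin
      𝒵 x                                 ≡⟨ sym (ℕP.m+n∸n≡m (𝒵 x) (#nonzero x)) ⟩
      (𝒵 x ℕ.+ #nonzero x) ℕ.∸ #nonzero x ≡⟨ cong₂ ℕ._∸_ (𝒵+#nonzero x) #nonzero≡ ⟩
      d ℕ.∸ (d ℕ.∸ α)                     ≡⟨ ℕP.m∸[m∸n]≡n α≤d ⟩
      α                                   ∎)
    where open ≡-Reasoning

  LHS≗ΣΠ : ∀ {d} (m : Vec Carrier d) α → α ≤ d → LHS m α s ≗ ΣL (subsetsOfSize d (d ℕ.∸ α)) (ΠΣ*f m)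
  LHS≗ΣΠ {d} m α α≤d = begin
    LHS m α s                                                         ≈⟨ ΣL-cong (N d α) (χ₁-factorises m) ⟩
    ΣL (N d α) (Πf m)                                                 ≈⟨ ΣL-filter (λ x → 𝒵 x ℕ.≟ α) (allVecs d) (Πf m) ⟩
    ΣL (allVecs d) (λ x → if does (𝒵 x ℕ.≟ α) then Πf m x else zeroζ) ≈⟨ ΣL-cong (allVecs d) same-condition ⟩
    ΣVec m size-is                                                    ≈⟨ expansion m size-is ⟩
    ΣSub m size-is                                                    ≈⟨ (λ k → sym (ΣL-filter (λ I → ∣ I ∣ ℕ.≟ (d ℕ.∸ α)) (allSubsets d) (ΠΣ*f m) k)) ⟩
    ΣL (subsetsOfSize d (d ℕ.∸ α)) (ΠΣ*f m)                           ∎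
    where
    open ≗-Reasoning
    size-is : ℕ → Bool
    size-is n = does (n ℕ.≟ (d ℕ.∸ α))
    same-condition : ∀ x → (if does (𝒵 x ℕ.≟ α) then Πf m x else zeroζ) ≗ (if size-is (#nonzero x) then Πf m x else zeroζ)
    same-condition x k = cong (λ b → (if b then Πf m x else zeroζ) k) (Decidable.does-⇔ (𝒵≡α⇔#nonzero≡d-α α α≤d x) (𝒵 x ℕ.≟ α) (#nonzero x ℕ.≟ (d ℕ.∸ α)))

  LHS≃RHS≠0 : ∀ {d} (m : Vec Carrier d) α → α ≤ d → (s≢0 : ¬ s ≡ 0#) → LHS m α s ≃ RHS≠0 m α s
  LHS≃RHS≠0 {d} m α α≤d s≢0 = ≃-trans (≗⇒≃ (LHS≗ΣΠ m α α≤d))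
    (ΣL-≃ (subsetsOfSize d (d ℕ.∸ α)) (λ I → ΠFin-≃ (λ i →
      if-≃ ⌊ lookup I i Bool.≟ true ⌋ oneζ (NonzeroQuadratic.Σ*term≃ s≢0 (lookup m i)))))

  module _ (s≡0 : s ≡ 0#) where
    open ZeroQuadratic s≡0

    ΠzeroFactor : ∀ {d} → Vec Carrier d → Subset d → ℤ
    ΠzeroFactor []       []      = ⁺ 1
    ΠzeroFactor (m ∷ ms) (b ∷ I) = (if ⌊ b Bool.≟ true ⌋ then zeroFactor m else ⁺ 1) ℤ.* ΠzeroFactor ms I

    ΠΣ*f≃ΠzeroFactor : ∀ {d} (m : Vec Carrier d) I → ΠΣ*f m I ≃ ⟦ ΠzeroFactor m I ⟧
    ΠΣ*f≃ΠzeroFactor m I = ≃-trans (ΠFin-≃ (λ i → if-≃ ⌊ lookup I i Bool.≟ true ⌋ oneζ (Σ*term≃ (lookup m i))))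
                                   (≗⇒≃ (Π⟦⟧ m I))
      where
      Π⟦⟧ : ∀ {d} (m : Vec Carrier d) I →
            ΠFin (λ i → if ⌊ lookup I i Bool.≟ true ⌋ then ⟦ zeroFactor (lookup m i) ⟧ else oneζ) ≗ ⟦ ΠzeroFactor m I ⟧
      Π⟦⟧ []       []      k = refl
      Π⟦⟧ (m ∷ ms) (b ∷ I) k = trans (⊗-congʳ (factor b) (Π⟦⟧ ms I) k) (trans (⊗-congˡ _ (factor≗ b) k) (⟦⟧-⊗-⟦⟧ _ _ k))
        where
        factor : Bool → Zζ p
        factor b = if ⌊ b Bool.≟ true ⌋ then ⟦ zeroFactor m ⟧ else oneζ
        factor≗ : ∀ b → factor b ≗ ⟦ (if ⌊ b Bool.≟ true ⌋ then zeroFactor m else ⁺ 1) ⟧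
        factor≗ true  _ = refl
        factor≗ false _ = refl

    𝒵ᵢ≤∣∣ : ∀ {d} (m : Vec Carrier d) I → 𝒵ᵢ m I ≤ ∣ I ∣
    𝒵ᵢ≤∣∣ []       []          = z≤n
    𝒵ᵢ≤∣∣ (m ∷ ms) (false ∷ I) = 𝒵ᵢ≤∣∣ ms I
    𝒵ᵢ≤∣∣ (m ∷ ms) (true ∷ I) with m ≟ 0#
    ... | yes _ = s≤s (𝒵ᵢ≤∣∣ ms I)
    ... | no _  = ℕP.m≤n⇒m≤1+n (𝒵ᵢ≤∣∣ ms I)

    -- Each i ∈ I contributes q - 1 if m_i = 0 and -1 otherwise.
    ΠzeroFactor≡ : ∀ {d} (m : Vec Carrier d) I →
                   ΠzeroFactor m I ≡ (⁺ q ℤ.- ⁺ 1) ℤ.^ 𝒵ᵢ m I ℤ.* (ℤ.- ⁺ 1) ℤ.^ (∣ I ∣ ℕ.∸ 𝒵ᵢ m I)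
    ΠzeroFactor≡ []       []          = refl
    ΠzeroFactor≡ (m ∷ ms) (false ∷ I) = trans (ℤP.*-identityˡ _) (ΠzeroFactor≡ ms I)
    ΠzeroFactor≡ (m ∷ ms) (true ∷ I) with m ≟ 0#
    ... | yes _ = trans (cong ((⁺ q ℤ.- ⁺ 1) ℤ.*_) (ΠzeroFactor≡ ms I)) (sym (ℤP.*-assoc (⁺ q ℤ.- ⁺ 1) _ _))
    ... | no _  = begin
      ℤ.- ⁺ 1 ℤ.* ΠzeroFactor ms I                          ≡⟨ cong (ℤ.- ⁺ 1 ℤ.*_) (ΠzeroFactor≡ ms I) ⟩
      ℤ.- ⁺ 1 ℤ.* (Q ℤ.^ z ℤ.* (ℤ.- ⁺ 1) ℤ.^ (∣ I ∣ ℕ.∸ z))  ≡⟨ solve 3 (λ n a b → n :* (a :* b) := a :* (n :* b)) refl (ℤ.- ⁺ 1) (Q ℤ.^ z) _ ⟩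
      Q ℤ.^ z ℤ.* (ℤ.- ⁺ 1) ℤ.^ suc (∣ I ∣ ℕ.∸ z)            ≡⟨ cong (λ e → Q ℤ.^ z ℤ.* (ℤ.- ⁺ 1) ℤ.^ e) (sym (ℕP.+-∸-assoc 1 (𝒵ᵢ≤∣∣ ms I))) ⟩
      Q ℤ.^ z ℤ.* (ℤ.- ⁺ 1) ℤ.^ (suc ∣ I ∣ ℕ.∸ z)            ∎
      where
      open ≡-Reasoning
      open +-*-Solver using (solve; _:*_; _:=_)
      Q : ℤ
      Q = ⁺ q ℤ.- ⁺ 1
      z : ℕ
      z = 𝒵ᵢ ms I

    LHS≃RHS0 : ∀ {d} (m : Vec Carrier d) α → α ≤ d → LHS m α s ≃ RHS0 m α
    LHS≃RHS0 {d} m α α≤d = begin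
      LHS m α s                                             ≈⟨ ≗⇒≃ (LHS≗ΣΠ m α α≤d) ⟩
      ΣL (subsetsOfSize d (d ℕ.∸ α)) (ΠΣ*f m)               ≈⟨ ΣL-≃ (subsetsOfSize d (d ℕ.∸ α)) (ΠΣ*f≃ΠzeroFactor m) ⟩
      ΣL (subsetsOfSize d (d ℕ.∸ α)) (λ I → ⟦ ΠzeroFactor m I ⟧)
                                                            ≈⟨ ΣL-filter-≃ (λ I → ∣ I ∣ ℕ.≟ (d ℕ.∸ α)) (allSubsets d) closed-form ⟩
      RHS0 m α                                              ∎
      where
      open ≃-Reasoning
      closed-form : ∀ I → ∣ I ∣ ≡ d ℕ.∸ α → ⟦ ΠzeroFactor m I ⟧ ≃ ⟦ (⁺ q ℤ.- ⁺ 1) ℤ.^ 𝒵ᵢ m I ℤ.* (ℤ.- ⁺ 1) ℤ.^ (d ℕ.∸ α ℕ.∸ 𝒵ᵢ m I) ⟧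
      closed-form I ∣I∣≡ = ≗⇒≃ (λ k → cong (λ z → ⟦ z ⟧ k)
        (trans (ΠzeroFactor≡ m I) (cong (λ e → (⁺ q ℤ.- ⁺ 1) ℤ.^ 𝒵ᵢ m I ℤ.* (ℤ.- ⁺ 1) ℤ.^ (e ℕ.∸ 𝒵ᵢ m I)) ∣I∣≡)))

lemma3p1 : (F : FiniteField) → let open Setup F in
    (d : ℕ) → 1 ≤ d → (m : Vec Carrier d) → (α : ℕ) → α ≤ d → (s : Carrier) →
      ((¬ (s ≡ 0#)) → LHS m α s ≈ RHS≠0 m α s)
      × (s ≡ 0# → LHS m α s ≈ RHS0 m α)
lemma3p1 F d _ m α α≤d s =
    (λ s≢0 → ≃⇒≈ (LHS≃RHS≠0 m α α≤d s≢0))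
  , (λ s≡0 → ≃⇒≈ (LHS≃RHS0 s≡0 m α α≤d))
  where
  open FiniteField F using (p)
  open FieldProperties F using (p≥2)
  open Cyclotomic p p≥2 using (≃⇒≈)
  open CharacterSumOverNα F s
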